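{- (Sym$_1$) Every elementary lattice-regular one-dimensional lattice simplex (segment) has unit lattice length. (Sym$_n$, $n>1$) Let $S^n_p$ denote the simplex in $\mathbb R^n$ with vertices $O$, $O+\bar e_i$ for $i=1,\dots,n-1$, and $O+(p-1)\sum_{k=1}^{n-1}\bar e_k+p\bar e_n$. Then: (i) for every positive integer $p$ dividing $n+1$, the simplex $S^n_p$ is elementary and lattice-regular; (ii) no two of the simplices in (i) (for distinct such $p$) are lattice-congruent; (iii) every elementary lattice-regular $n$-dimensional lattice simplex in $\mathbb R^n$ is lattice-congruent to $S^n_p$ for some positive divisor $p$ of $n+1$.
   Context: The lattice is $\mathbb Z^n\subset\mathbb R^n$ with standard basis $\bar e_1,\dots,\bar e_n$ and origin $O$. A lattice polytope has vertices in $\mathbb Z^n$. The lattice length of a segment with lattice endpoints is the number of lattice points on it minus one. A lattice-affine transformation is an affine bijection of $\mathbb R^n$ mapping $\mathbb Z^n$ onto itself; lattice polytopes are lattice-congruent if one is mapped onto the other by such a map. A face-flag of an $n$-dimensional polytope $P$ is a chain $P=F_n\supset F_{n-1}\supset\dots\supset F_0$ of faces with $\dim F_i=i$; $P$ is lattice-regular if for any two face-flags some lattice-affine transformation maps $P$ onto itself and one flag onto the other. If $Q$ has vertices $O+\bar v_i$, its $t$-multiple is the polytope with vertices $O+t\bar v_i$; a lattice polytope $P$ is elementary if for no integer $t>1$ and no lattice polytope $Q$ is $P$ lattice-congruent to the $t$-multiple of $Q$. (A one-dimensional lattice simplex is considered inside a line with its induced lattice.) -}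

module Defs where

open import Data.Nat as ℕ using (ℕ; zero; suc)
open import Data.Integer as ℤ using (ℤ; +_; _+_; _*_; _-_)
open import Data.Fin as Fin using (Fin; zero; suc; toℕ)
open import Data.Fin.Subset as Sub using (Subset; _∈_; _⊆_)
open import Data.Product using (Σ; ∃; ∃-syntax; _×_; _,_)
open import Data.Empty using (⊥)
open import Relation.Nullary using (¬_; yes; no)
open import Relation.Binary.PropositionalEquality using (_≡_)

Pt : ℕ → Set
Pt n = Fin n → ℤ

_≈ₚ_ : ∀ {n} → Pt n → Pt n → Set
x ≈ₚ y = ∀ k → x k ≡ y k

sumF : ∀ {n} → (Fin n → ℤ) → ℤ
sumF {zero}  f = + 0
sumF {suc n} f = f zero + sumF (λ i → f (suc i))

Mat : ℕ → Set
Mat n = Fin n → Fin n → ℤ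

idMat : ∀ {n} → Mat n
idMat i j with i Fin.≟ j
... | yes _ = + 1
... | no  _ = + 0

_·M_ : ∀ {n} → Mat n → Mat n → Mat n
(A ·M B) i j = sumF (λ k → A i k * B k j)

_·V_ : ∀ {n} → Mat n → Pt n → Pt n
(A ·V x) i = sumF (λ k → A i k * x k)

record LatticeAffine (n : ℕ) : Set where
  field
    A     : Mat n
    A⁻¹   : Mat n
    b     : Pt n
    inv-r : ∀ i j → (A ·M A⁻¹) i j ≡ idMat i j
    inv-l : ∀ i j → (A⁻¹ ·M A) i j ≡ idMat i j

apply : ∀ {n} → LatticeAffine n → Pt n → Pt n
apply f x k = (LatticeAffine.A f ·V x) k + LatticeAffine.b f k

-- Lattice polytopes are given by the (finite) family of their vertices.
-- A lattice n-simplex in ℤⁿ is a family of n+1 affinely independent points.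

Simplex : ℕ → Set
Simplex n = Fin (suc n) → Pt n

IsSimplex : ∀ {n} → Simplex n → Set
IsSimplex {n} v =
  (c : Fin (suc n) → ℤ) → sumF c ≡ + 0 →
  (∀ k → sumF (λ i → c i * v i k) ≡ + 0) → ∀ i → c i ≡ + 0

MapsOnto : ∀ {n a b} → LatticeAffine n → (Fin a → Pt n) → (Fin b → Pt n) → Set
MapsOnto f v w =
  (∀ i → ∃[ j ] (apply f (v i) ≈ₚ w j)) × (∀ j → ∃[ i ] (apply f (v i) ≈ₚ w j))

LatticeCongruent : ∀ {n a b} → (Fin a → Pt n) → (Fin b → Pt n) → Set
LatticeCongruent {n} v w = ∃[ f ] MapsOnto {n} f v w

multiple : ∀ {n m} → ℕ → (Fin m → Pt n) → (Fin m → Pt n)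
multiple t q i k = + t * q i k

Elementary : ∀ {n m} → (Fin m → Pt n) → Set
Elementary {n} v =
  ¬ (∃[ t ] (2 ℕ.≤ t × ∃[ m ] ∃[ q ] LatticeCongruent v (multiple {n} {m} t q)))

-- Faces and face-flags of a simplex.
-- Faces of a simplex are exactly the convex hulls of nonempty subsets of
-- its vertices; a d-dimensional face corresponds to a (d+1)-subset.

record Flag (n : ℕ) : Set where
  field
    F      : Fin (suc n) → Subset (suc n)
    card   : ∀ d → Sub.∣ F d ∣ ≡ suc (toℕ d)
    nested : ∀ (d : Fin n) → F (Fin.inject₁ d) ⊆ F (suc d)

MapsFace : ∀ {n} → LatticeAffine n → Simplex n → Subset (suc n) → Subset (suc n) → Set
MapsFace f v S T =
  (∀ i → i ∈ S → ∃[ j ] (j ∈ T × apply f (v i) ≈ₚ v j)) ×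
  (∀ j → j ∈ T → ∃[ i ] (i ∈ S × apply f (v i) ≈ₚ v j))

LatticeRegular : ∀ {n} → Simplex n → Set
LatticeRegular {n} v =
  (Φ Ψ : Flag n) → ∃[ f ]
    (MapsOnto f v v × (∀ d → MapsFace f v (Flag.F Φ d) (Flag.F Ψ d)))

-- Lattice length of a segment in the line ℤ¹ (number of lattice points on
-- it minus one), i.e. |a - b| for endpoints a, b.

latticeLength₁ : Simplex 1 → ℕ
latticeLength₁ v = ℤ.∣ v zero zero - v (suc zero) zero ∣

-- The simplex Sⁿ_p : vertices O, O + e_i (i = 1..n-1),
-- O + (p-1)(e_1 + ... + e_{n-1}) + p e_n.
-- Vertex index 0 ↦ O;  suc i ↦ e_{i+1} if i+1 < n, special vertex if i+1 = n.

S : (n p : ℕ) → Simplex n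
S n p zero j = + 0
S n p (suc i) j with suc (toℕ i) ℕ.≟ n | suc (toℕ j) ℕ.≟ n
... | no _  | _ = idMat i j
... | yes _ | yes _ = + p
... | yes _ | no _  = + p - + 1

-- A simplex is lattice-regular exactly when every permutation of its vertices is realised by a
-- lattice-affine map: flags correspond to orderings of the vertices.
--
-- If v is regular and elementary, its edges uᵢ = vᵢ₊₁ - v₀ are primitive. Writing a lattice point
-- as x = Σ βₖ uₖ with rational βₖ, the map exchanging v₀ and vᵢ₊₁ moves x by (Σβ + βᵢ) uᵢ, so every
-- Σβ + βᵢ is an integer; hence (n + 1)x is an integral combination of the vectors (n + 1)(vᵢ - b),
-- b the barycentre. Conversely, let v have this property, let Mⱼ be the coefficient sum for the
-- basis vector eⱼ, g = gcd(n + 1, M₁, …, Mₙ) and p = (n + 1)/g. Then Σ uₖ = p z for a lattice point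
-- z, and the matrix sending the edges of Sⁿₚ to the uₖ is unimodular, so v is congruent to Sⁿₚ.
-- Every relabelling of Sⁿₚ has the property too, which makes Sⁿₚ regular; it is elementary since
-- e₁ is one of its edges. Finally p is an invariant: the last coordinates of the edges of Sⁿₚ
-- generate pℤ. In dimension one, a segment of length L ≥ 2 is the L-multiple of a unit segment.

module Submission where

open import Defs
open import Data.Nat using (ℕ; suc; _≤_)
open import Data.Nat.Divisibility using (_∣_)
open import Data.Product using (Σ; ∃; ∃-syntax; _×_; _,_)
open import Relation.Nullary using (¬_)
open import Relation.Binary.PropositionalEquality using (_≡_; _≢_)
open import Data.Nat as ℕ using (zero; z≤n; s≤s)
import Data.Nat.Properties as ℕP
import Data.Nat.Divisibility as ℕD
open import Data.Nat.GCD using (module GCD; module Bézout)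
open import Data.Bool using (Bool; true; false; T; if_then_else_)
open import Data.Bool.Properties using (T-≡)
open import Data.Integer as ℤ using (ℤ; +_; _+_; _*_; _-_; -_)
import Data.Integer.Properties as ℤP
open import Data.Integer.Divisibility.Signed as ℤD using (divides; ∣ᵤ⇒∣; ∣⇒∣ᵤ)
open import Data.Integer.Tactic.RingSolver using (solve-∀)
open import Data.Fin as Fin using (Fin; zero; suc; toℕ; fromℕ; inject₁; punchIn; punchOut)
import Data.Fin.Properties as FinP
open import Data.Fin.Subset as Subset using (Subset; _∈_; _∉_; _⊆_; ∣_∣)
open import Data.Fin.Subset.Properties as SubsetP
  using (∉⊥; ∈⊤; ∣⊥∣≡0; ∣p∣≡n⇒p≡⊤; x∈p∧x≢y⇒x∈p-y; x∈p⇒∣p-x∣<∣p∣; p⊂q⇒∣p∣<∣q∣)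
open import Data.Fin.Permutation as Perm using (Permutation′; _⟨$⟩ʳ_; _⟨$⟩ˡ_; _∘ₚ_; transpose)
open import Data.Vec using (tabulate)
import Data.Vec.Properties as VecP
open import Data.Vec.Functional using (insertAt; _∷_)
open import Data.Vec.Functional.Properties using (insertAt-lookup; insertAt-punchIn)
open import Data.Product using (∃₂; proj₁; proj₂; map₂)
open import Data.Sum using (_⊎_; inj₁; inj₂)
open import Data.Empty using (⊥; ⊥-elim)
open import Function using (_∘_; id; _⇔_; mk⇔; Equivalence)
open import Relation.Binary.PropositionalEquality
  using (refl; sym; trans; cong; cong₂; subst; subst₂; module ≡-Reasoning)
open import Relation.Nullary using (¬?; yes; no; Dec)
open import Relation.Nullary.Decidable using (decidable-stable)
open import Relation.Unary using (Decidable)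
open import Algebra.Properties.AbelianGroup ℤP.+-0-abelianGroup using (inverseˡ-unique)
open import Algebra.Properties.CommutativeSemigroup ℤP.*-commutativeSemigroup using (x∙yz≈y∙xz; xy∙z≈y∙xz)
open import Algebra.Properties.Semiring.Sum ℤP.+-*-semiring
  using (sum; sum-cong-≗; ∑-distrib-+; ∑-comm; sum-remove; sum-permute; sum-replicate-zero; *-distribˡ-sum; *-distribʳ-sum)
import Algebra.Properties.CommutativeMonoid.Sum ℕP.+-0-commutativeMonoid as Σℕ

open Equivalence using (to; from)
open ≡-Reasoning

private
  variable
    k m n : ℕ

*-distribˡ-- : ∀ (a b c : ℤ) → a * (b - c) ≡ a * b - a * c
*-distribˡ-- = solve-∀

sumF≡sum : (f : Fin n → ℤ) → sumF f ≡ sum f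
sumF≡sum {zero}  f = refl
sumF≡sum {suc n} f = cong (_+_ (f zero)) (sumF≡sum (f ∘ suc))

sum-zero : (f : Fin n → ℤ) → (∀ i → f i ≡ + 0) → sum f ≡ + 0
sum-zero {n} f f≡0 = trans (sum-cong-≗ f≡0) (sum-replicate-zero n)

sum-neg : (f : Fin n → ℤ) → sum (λ i → - f i) ≡ - sum f
sum-neg f = begin
  sum (λ i → - f i)        ≡⟨ sum-cong-≗ (λ i → sym (ℤP.-1*i≡-i (f i))) ⟩
  sum (λ i → ℤ.-1ℤ * f i)  ≡⟨ *-distribˡ-sum ℤ.-1ℤ f ⟨
  ℤ.-1ℤ * sum f            ≡⟨ ℤP.-1*i≡-i (sum f) ⟩
  - sum f                  ∎

∑-distrib-- : (f g : Fin n → ℤ) → sum (λ i → f i - g i) ≡ sum f - sum g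
∑-distrib-- f g = trans (∑-distrib-+ f (λ i → - g i)) (cong (_+_ (sum f)) (sum-neg g))

sum-const : (a : ℤ) → sum (λ (_ : Fin n) → a) ≡ + n * a
sum-const {zero}  a = sym (ℤP.*-zeroˡ a)
sum-const {suc n} a = begin
  a + sum (λ (_ : Fin n) → a)  ≡⟨ cong (_+_ a) (sum-const {n} a) ⟩
  a + + n * a                  ≡⟨ a+n*a≡[1+n]*a a (+ n) ⟩
  + suc n * a                  ∎
  where
  a+n*a≡[1+n]*a : ∀ (a n : ℤ) → a + n * a ≡ (+ 1 + n) * a
  a+n*a≡[1+n]*a = solve-∀

idMat-diag : (i : Fin n) → idMat i i ≡ + 1
idMat-diag i with i Fin.≟ i
... | yes _   = refl
... | no i≢i = ⊥-elim (i≢i refl)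

idMat-off : {i j : Fin n} → i ≢ j → idMat i j ≡ + 0
idMat-off {i = i} {j} i≢j with i Fin.≟ j
... | yes i≡j = ⊥-elim (i≢j i≡j)
... | no _    = refl

idMat-sym : (i j : Fin n) → idMat i j ≡ idMat j i
idMat-sym i j with i Fin.≟ j
... | yes refl = sym (idMat-diag i)
... | no i≢j   = sym (idMat-off (i≢j ∘ sym))

idMat-≡ : {i j : Fin n} → i ≡ j → idMat i j ≡ + 1
idMat-≡ refl = idMat-diag _

sum-idMat : (f : Fin n → ℤ) (j : Fin n) → sum (λ k → f k * idMat k j) ≡ f j
sum-idMat {suc n} f j = begin
  sum g                               ≡⟨ sum-remove {i = j} g ⟩
  g j + sum (λ k → g (punchIn j k))   ≡⟨ cong₂ _+_ (cong (f j *_) (idMat-diag j)) (sum-zero _ off) ⟩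
  f j * + 1 + + 0                     ≡⟨ trans (ℤP.+-identityʳ _) (ℤP.*-identityʳ _) ⟩
  f j                                 ∎
  where
  g : Fin (suc n) → ℤ
  g = λ k → f k * idMat k j
  off : ∀ k → g (punchIn j k) ≡ + 0
  off k = trans (cong (f (punchIn j k) *_) (idMat-off (FinP.punchInᵢ≢i j k))) (ℤP.*-zeroʳ (f (punchIn j k)))

sum-idMatˡ : (f : Fin n → ℤ) (j : Fin n) → sum (λ k → idMat j k * f k) ≡ f j
sum-idMatˡ f j = trans (sum-cong-≗ (λ k → trans (ℤP.*-comm (idMat j k) (f k)) (cong (f k *_) (idMat-sym j k)))) (sum-idMat f j)

infixl 26 _+ₚ_ _-ₚ_
infixr 27 _*ₚ_

_+ₚ_ : Pt n → Pt n → Pt n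
(x +ₚ y) r = x r + y r

_-ₚ_ : Pt n → Pt n → Pt n
(x -ₚ y) r = x r - y r

_*ₚ_ : ℤ → Pt n → Pt n
(t *ₚ x) r = t * x r

0ₚ : Pt n
0ₚ _ = + 0

𝟙 : Pt n
𝟙 _ = + 1

e : Fin n → Pt n
e = idMat

lincomb : (Fin m → ℤ) → (Fin m → Pt n) → Pt n
lincomb c w r = sum (λ j → c j * w j r)

lincomb-e : (x : Pt n) → lincomb x e ≈ₚ x
lincomb-e x r = sum-idMat x r

·V-sum : (A : Mat n) (x : Pt n) (r : Fin n) → (A ·V x) r ≡ sum (λ k → A r k * x k)
·V-sum A x r = sumF≡sum (λ k → A r k * x k)

·V-cong : (A : Mat n) {x y : Pt n} → x ≈ₚ y → (A ·V x) ≈ₚ (A ·V y)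
·V-cong A {x} {y} x≈y r = begin
  (A ·V x) r               ≡⟨ ·V-sum A x r ⟩
  sum (λ k → A r k * x k)  ≡⟨ sum-cong-≗ (λ k → cong (A r k *_) (x≈y k)) ⟩
  sum (λ k → A r k * y k)  ≡⟨ ·V-sum A y r ⟨
  (A ·V y) r               ∎

·V-e : (A : Mat n) (j r : Fin n) → (A ·V e j) r ≡ A r j
·V-e A j r = begin
  (A ·V e j) r                   ≡⟨ ·V-sum A (e j) r ⟩
  sum (λ k → A r k * idMat j k)  ≡⟨ sum-cong-≗ (λ k → cong (A r k *_) (idMat-sym j k)) ⟩
  sum (λ k → A r k * idMat k j)  ≡⟨ sum-idMat (A r) j ⟩
  A r j                          ∎

idMat-·V : (x : Pt n) → (idMat ·V x) ≈ₚ x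
idMat-·V x r = begin
  (idMat ·V x) r                 ≡⟨ ·V-sum idMat x r ⟩
  sum (λ k → idMat r k * x k)    ≡⟨ sum-idMatˡ x r ⟩
  x r                            ∎

·V-*ₚ : (A : Mat n) (t : ℤ) (x : Pt n) → (A ·V (t *ₚ x)) ≈ₚ t *ₚ (A ·V x)
·V-*ₚ A t x r = begin
  (A ·V (t *ₚ x)) r                ≡⟨ ·V-sum A (t *ₚ x) r ⟩
  sum (λ k → A r k * (t * x k))    ≡⟨ sum-cong-≗ (λ k → x∙yz≈y∙xz (A r k) t (x k)) ⟩
  sum (λ k → t * (A r k * x k))    ≡⟨ *-distribˡ-sum t (λ k → A r k * x k) ⟨
  t * sum (λ k → A r k * x k)      ≡⟨ cong (t *_) (·V-sum A x r) ⟨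
  t * (A ·V x) r                   ∎

·V-+ₚ : (A : Mat n) (x y : Pt n) → (A ·V (x +ₚ y)) ≈ₚ (A ·V x) +ₚ (A ·V y)
·V-+ₚ A x y r = begin
  (A ·V (x +ₚ y)) r                                   ≡⟨ ·V-sum A (x +ₚ y) r ⟩
  sum (λ k → A r k * (x k + y k))                     ≡⟨ sum-cong-≗ (λ k → ℤP.*-distribˡ-+ (A r k) (x k) (y k)) ⟩
  sum (λ k → A r k * x k + A r k * y k)               ≡⟨ ∑-distrib-+ (λ k → A r k * x k) (λ k → A r k * y k) ⟩
  sum (λ k → A r k * x k) + sum (λ k → A r k * y k)   ≡⟨ cong₂ _+_ (·V-sum A x r) (·V-sum A y r) ⟨
  (A ·V x) r + (A ·V y) r                             ∎

·V--ₚ : (A : Mat n) (x y : Pt n) → (A ·V (x -ₚ y)) ≈ₚ (A ·V x) -ₚ (A ·V y)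
·V--ₚ A x y r = begin
  (A ·V (x -ₚ y)) r                    ≡⟨ ·V-cong A (λ k → cong (_+_ (x k)) (sym (ℤP.-1*i≡-i (y k)))) r ⟩
  (A ·V (x +ₚ ℤ.-1ℤ *ₚ y)) r           ≡⟨ ·V-+ₚ A x (ℤ.-1ℤ *ₚ y) r ⟩
  (A ·V x) r + (A ·V (ℤ.-1ℤ *ₚ y)) r   ≡⟨ cong (_+_ ((A ·V x) r)) (trans (·V-*ₚ A ℤ.-1ℤ y r) (ℤP.-1*i≡-i _)) ⟩
  (A ·V x) r - (A ·V y) r              ∎

·V-lincomb : (A : Mat n) (c : Fin m → ℤ) (w : Fin m → Pt n) →
             (A ·V lincomb c w) ≈ₚ lincomb c (λ j → A ·V w j)
·V-lincomb A c w r = begin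
  (A ·V lincomb c w) r                                  ≡⟨ ·V-sum A (lincomb c w) r ⟩
  sum (λ k → A r k * sum (λ j → c j * w j k))           ≡⟨ sum-cong-≗ (λ k → *-distribˡ-sum (A r k) (λ j → c j * w j k)) ⟩
  sum (λ k → sum (λ j → A r k * (c j * w j k)))         ≡⟨ ∑-comm (λ k j → A r k * (c j * w j k)) ⟩
  sum (λ j → sum (λ k → A r k * (c j * w j k)))         ≡⟨ sum-cong-≗ (λ j → sum-cong-≗ (λ k → x∙yz≈y∙xz (A r k) (c j) (w j k))) ⟩
  sum (λ j → sum (λ k → c j * (A r k * w j k)))         ≡⟨ sum-cong-≗ (λ j → *-distribˡ-sum (c j) (λ k → A r k * w j k)) ⟨
  sum (λ j → c j * sum (λ k → A r k * w j k))           ≡⟨ sum-cong-≗ (λ j → cong (c j *_) (·V-sum A (w j) r)) ⟨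
  lincomb c (λ j → A ·V w j) r                          ∎

·V-columns : (A : Mat n) (x : Pt n) → (A ·V x) ≈ₚ lincomb x (λ k r → A r k)
·V-columns A x r = trans (·V-sum A x r) (sum-cong-≗ (λ k → ℤP.*-comm (A r k) (x k)))

·V-assoc : (A B : Mat n) (x : Pt n) → ((A ·M B) ·V x) ≈ₚ (A ·V (B ·V x))
·V-assoc A B x r = begin
  ((A ·M B) ·V x) r                         ≡⟨ ·V-columns (A ·M B) x r ⟩
  lincomb x (λ k → A ·V (λ l → B l k)) r    ≡⟨ ·V-lincomb A x (λ k l → B l k) r ⟨
  (A ·V lincomb x (λ k l → B l k)) r        ≡⟨ ·V-cong A (λ l → ·V-columns B x l) r ⟨
  (A ·V (B ·V x)) r                         ∎

·V-inverse : (A B : Mat n) → (∀ i j → (A ·M B) i j ≡ idMat i j) → ∀ x → (A ·V (B ·V x)) ≈ₚ x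
·V-inverse A B AB≡I x r = begin
  (A ·V (B ·V x)) r                ≡⟨ ·V-assoc A B x r ⟨
  ((A ·M B) ·V x) r                ≡⟨ ·V-sum (A ·M B) x r ⟩
  sum (λ k → (A ·M B) r k * x k)   ≡⟨ sum-cong-≗ (λ k → cong (_* x k) (AB≡I r k)) ⟩
  sum (λ k → idMat r k * x k)      ≡⟨ ·V-sum idMat x r ⟨
  (idMat ·V x) r                   ≡⟨ idMat-·V x r ⟩
  x r                              ∎

·M≡idMat : (A B : Mat n) → (∀ x → (A ·V (B ·V x)) ≈ₚ x) → ∀ i j → (A ·M B) i j ≡ idMat i j
·M≡idMat A B AB≈id i j = begin
  (A ·M B) i j                     ≡⟨ ·V-cong A (λ k → ·V-e B j k) i ⟨
  (A ·V (B ·V e j)) i              ≡⟨ AB≈id (e j) i ⟩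
  idMat j i                        ≡⟨ idMat-sym j i ⟩
  idMat i j                        ∎

mkLatticeAffine : (A A⁻¹ : Mat n) (b : Pt n) →
                  (∀ x → (A ·V (A⁻¹ ·V x)) ≈ₚ x) → (∀ x → (A⁻¹ ·V (A ·V x)) ≈ₚ x) → LatticeAffine n
mkLatticeAffine A A⁻¹ b right left = record
  { A = A ; A⁻¹ = A⁻¹ ; b = b ; inv-r = ·M≡idMat A A⁻¹ right ; inv-l = ·M≡idMat A⁻¹ A left }

translation : Pt n → LatticeAffine n
translation b = mkLatticeAffine idMat idMat b idMat²≈id idMat²≈id
  where
  idMat²≈id : ∀ x → (idMat ·V (idMat ·V x)) ≈ₚ x
  idMat²≈id x r = trans (idMat-·V (idMat ·V x) r) (idMat-·V x r)

apply-translation : (b x : Pt n) → apply (translation b) x ≈ₚ x +ₚ b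
apply-translation b x r = cong (_+ b r) (idMat-·V x r)

apply-cong : (f : LatticeAffine n) {x y : Pt n} → x ≈ₚ y → apply f x ≈ₚ apply f y
apply-cong f x≈y r = cong (_+ LatticeAffine.b f r) (·V-cong (LatticeAffine.A f) x≈y r)

module _ (f : LatticeAffine n) where
  open LatticeAffine f

  apply-diff : (x y : Pt n) → apply f x -ₚ apply f y ≈ₚ (A ·V (x -ₚ y))
  apply-diff x y r = begin
    ((A ·V x) r + b r) - ((A ·V y) r + b r)  ≡⟨ [a+c]-[b+c]≡a-b ((A ·V x) r) ((A ·V y) r) (b r) ⟩
    (A ·V x) r - (A ·V y) r                  ≡⟨ ·V--ₚ A x y r ⟨
    (A ·V (x -ₚ y)) r                        ∎
    where
    [a+c]-[b+c]≡a-b : ∀ (a b c : ℤ) → (a + c) - (b + c) ≡ a - b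
    [a+c]-[b+c]≡a-b = solve-∀

  A⁻¹-·V-A : ∀ x → (A⁻¹ ·V (A ·V x)) ≈ₚ x
  A⁻¹-·V-A = ·V-inverse A⁻¹ A inv-l

  A-·V-A⁻¹ : ∀ x → (A ·V (A⁻¹ ·V x)) ≈ₚ x
  A-·V-A⁻¹ = ·V-inverse A A⁻¹ inv-r

  apply-injective : {x y : Pt n} → apply f x ≈ₚ apply f y → x ≈ₚ y
  apply-injective {x} {y} fx≈fy r = ℤP.i-j≡0⇒i≡j (x r) (y r) (begin
    (x -ₚ y) r                      ≡⟨ A⁻¹-·V-A (x -ₚ y) r ⟨
    (A⁻¹ ·V (A ·V (x -ₚ y))) r      ≡⟨ ·V-cong A⁻¹ (λ k → trans (sym (apply-diff x y k)) (ℤP.i≡j⇒i-j≡0 (fx≈fy k))) r ⟩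
    (A⁻¹ ·V 0ₚ) r                   ≡⟨ trans (·V-sum A⁻¹ 0ₚ r) (sum-zero _ (λ k → ℤP.*-zeroʳ (A⁻¹ r k))) ⟩
    + 0                             ∎)

  inverse : LatticeAffine n
  inverse = mkLatticeAffine A⁻¹ A (ℤ.-1ℤ *ₚ (A⁻¹ ·V b)) A⁻¹-·V-A A-·V-A⁻¹

  apply-inverse : ∀ x → apply inverse (apply f x) ≈ₚ x
  apply-inverse x r = begin
    (A⁻¹ ·V apply f x) r + ℤ.-1ℤ * (A⁻¹ ·V b) r                    ≡⟨ cong (_+ ℤ.-1ℤ * (A⁻¹ ·V b) r) (·V-+ₚ A⁻¹ (A ·V x) b r) ⟩
    (A⁻¹ ·V (A ·V x)) r + (A⁻¹ ·V b) r + ℤ.-1ℤ * (A⁻¹ ·V b) r      ≡⟨ a+c+[-1]*c≡a ((A⁻¹ ·V (A ·V x)) r) ((A⁻¹ ·V b) r) ⟩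
    (A⁻¹ ·V (A ·V x)) r                                          ≡⟨ A⁻¹-·V-A x r ⟩
    x r                                                          ∎
    where
    a+c+[-1]*c≡a : ∀ (a c : ℤ) → a + c + ℤ.-1ℤ * c ≡ a
    a+c+[-1]*c≡a = solve-∀

  apply-inverse-≈ : {x y : Pt n} → apply f x ≈ₚ y → apply inverse y ≈ₚ x
  apply-inverse-≈ {x} fx≈y r = trans (apply-cong inverse (λ k → sym (fx≈y k)) r) (apply-inverse x r)

  mapsOnto-inverse : ∀ {a c} {v : Fin a → Pt n} {w : Fin c → Pt n} → MapsOnto f v w → MapsOnto inverse w v
  mapsOnto-inverse (v→w , v↞w) = (λ j → map₂ apply-inverse-≈ (v↞w j)) , (λ i → map₂ apply-inverse-≈ (v→w i))

+∣i∣≡s*i : ∀ i → ∃ λ s → + ℤ.∣ i ∣ ≡ s * i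
+∣i∣≡s*i i with ℤP.+∣i∣≡i⊎+∣i∣≡-i i
... | inj₁ ∣i∣≡i  = + 1 , trans ∣i∣≡i (sym (ℤP.*-identityˡ i))
... | inj₂ ∣i∣≡-i = ℤ.-1ℤ , trans ∣i∣≡-i (sym (ℤP.-1*i≡-i i))

pos-identity : ∀ k l p q r → k ℕ.+ l ℕ.* p ≡ q ℕ.* r → + k + + l * + p ≡ + q * + r
pos-identity k l p q r eq = begin
  + k + + l * + p    ≡⟨ cong (_+_ (+ k)) (ℤP.pos-* l p) ⟨
  + k + + (l ℕ.* p)  ≡⟨ ℤP.pos-+ k (l ℕ.* p) ⟨
  + (k ℕ.+ l ℕ.* p)  ≡⟨ cong +_ eq ⟩
  + (q ℕ.* r)        ≡⟨ ℤP.pos-* q r ⟩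
  + q * + r          ∎

bézout₂ : ∀ (a : ℕ) (c : ℤ) → ∃ λ d → d ∣ a × + d ℤD.∣ c × ∃₂ λ x y → + d ≡ x * + a + y * c
bézout₂ a c with Bézout.lemma a ℤ.∣ c ∣ | +∣i∣≡s*i c
... | Bézout.result d gcd identity | s , ∣c∣≡s*c =
  d , GCD.gcd∣m gcd , ∣ᵤ⇒∣ (GCD.gcd∣n gcd) , combination identity
  where
  combination : Bézout.Identity d a ℤ.∣ c ∣ → ∃₂ λ x y → + d ≡ x * + a + y * c
  combination (Bézout.+- x y eq) = + x , - (+ y * s) , (begin
    + d                                        ≡⟨ d≡[d+e]-e (+ d) (+ y * + ℤ.∣ c ∣) ⟩
    (+ d + + y * + ℤ.∣ c ∣) - + y * + ℤ.∣ c ∣  ≡⟨ cong₂ (λ u v → u - + y * v) (pos-identity d y ℤ.∣ c ∣ x a eq) ∣c∣≡s*c ⟩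
    + x * + a - + y * (s * c)                  ≡⟨ rearrange (+ x) (+ a) (+ y) s c ⟩
    + x * + a + - (+ y * s) * c                ∎)
    where
    d≡[d+e]-e : ∀ (d e : ℤ) → d ≡ (d + e) - e
    d≡[d+e]-e = solve-∀
    rearrange : ∀ (x a y s c : ℤ) → x * a - y * (s * c) ≡ x * a + - (y * s) * c
    rearrange = solve-∀
  combination (Bézout.-+ x y eq) = - + x , + y * s , (begin
    + d                                        ≡⟨ d≡[d+e]-e (+ d) (+ x * + a) ⟩
    (+ d + + x * + a) - + x * + a              ≡⟨ cong₂ (λ u v → u - v) (trans (pos-identity d x a y ℤ.∣ c ∣ eq) (cong (+ y *_) ∣c∣≡s*c)) refl ⟩
    + y * (s * c) - + x * + a                  ≡⟨ rearrange (+ x) (+ a) (+ y) s c ⟩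
    - + x * + a + + y * s * c                  ∎)
    where
    d≡[d+e]-e : ∀ (d e : ℤ) → d ≡ (d + e) - e
    d≡[d+e]-e = solve-∀
    rearrange : ∀ (x a y s c : ℤ) → y * (s * c) - x * a ≡ - x * a + y * s * c
    rearrange = solve-∀

bézout : (c : Fin m → ℤ) → ∃ λ g → (∀ j → + g ℤD.∣ c j) × ∃ λ (κ : Fin m → ℤ) → + g ≡ sum (λ j → κ j * c j)
bézout {zero} c = 0 , (λ ()) , (λ ()) , refl
bézout {suc m} c with bézout (c ∘ suc)
... | g , g∣c , κ , g≡Σκc with bézout₂ g (c zero)
... | d , d∣g , d∣c₀ , x , y , d≡xg+yc₀ = d , d∣c , κ′ , d≡Σκ′c
  where
  d∣c : ∀ j → + d ℤD.∣ c j
  d∣c zero    = d∣c₀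
  d∣c (suc j) = ℤD.∣-trans (∣ᵤ⇒∣ d∣g) (g∣c j)
  κ′ : Fin (suc m) → ℤ
  κ′ zero    = y
  κ′ (suc j) = x * κ j
  d≡Σκ′c : + d ≡ sum (λ j → κ′ j * c j)
  d≡Σκ′c = begin
    + d                                                 ≡⟨ d≡xg+yc₀ ⟩
    x * + g + y * c zero                                ≡⟨ cong (λ t → x * t + y * c zero) g≡Σκc ⟩
    x * sum (λ j → κ j * c (suc j)) + y * c zero       ≡⟨ cong (_+ y * c zero) (*-distribˡ-sum x (λ j → κ j * c (suc j))) ⟩
    sum (λ j → x * (κ j * c (suc j))) + y * c zero     ≡⟨ cong (_+ y * c zero) (sum-cong-≗ (λ j → sym (ℤP.*-assoc x (κ j) (c (suc j))))) ⟩
    sum (λ j → x * κ j * c (suc j)) + y * c zero       ≡⟨ ℤP.+-comm _ (y * c zero) ⟩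
    sum (λ j → κ′ j * c j)                             ∎

LinearlyIndependent : (Fin m → Pt n) → Set
LinearlyIndependent w = ∀ c → lincomb c w ≈ₚ 0ₚ → ∀ i → c i ≡ + 0

lincomb-insertAt : (c : Fin m → ℤ) (i : Fin (suc m)) (cᵢ : ℤ) (w : Fin (suc m) → Pt n) (r : Fin n) →
                   lincomb (insertAt c i cᵢ) w r ≡ cᵢ * w i r + sum (λ k → c k * w (punchIn i k) r)
lincomb-insertAt {m = m} c i cᵢ w r = begin
  sum (λ j → c′ j * w j r)                                          ≡⟨ sum-remove {i = i} (λ j → c′ j * w j r) ⟩
  c′ i * w i r + sum (λ k → c′ (punchIn i k) * w (punchIn i k) r)  ≡⟨ cong₂ _+_ (cong (_* w i r) (insertAt-lookup c i cᵢ))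
                                                                         (sum-cong-≗ (λ k → cong (_* w (punchIn i k) r) (insertAt-punchIn c i cᵢ k))) ⟩
  cᵢ * w i r + sum (λ k → c k * w (punchIn i k) r)                  ∎
  where
  c′ : Fin (suc m) → ℤ
  c′ = insertAt c i cᵢ

∑-linear : (α β : ℤ) (f g : Fin n → ℤ) → sum (λ k → α * f k - g k * β) ≡ α * sum f - sum g * β
∑-linear α β f g = begin
  sum (λ k → α * f k - g k * β)              ≡⟨ ∑-distrib-- (λ k → α * f k) (λ k → g k * β) ⟩
  sum (λ k → α * f k) - sum (λ k → g k * β)  ≡⟨ cong₂ _-_ (*-distribˡ-sum α f) (*-distribʳ-sum β g) ⟨
  α * sum f - sum g * β                      ∎

-- one step of Gaussian elimination, clearing the first coordinate with the pivot vector w i₀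
eliminate : (w : Fin (suc m) → Pt (suc n)) (i₀ : Fin (suc m)) → Fin m → Pt n
eliminate w i₀ k r = w i₀ zero * w (punchIn i₀ k) (suc r) - w (punchIn i₀ k) zero * w i₀ (suc r)

lift-relation : (w : Fin (suc m) → Pt (suc n)) (i₀ : Fin (suc m)) → w i₀ zero ≢ + 0 →
                (c′ : Fin m → ℤ) → (∃ λ k → c′ k ≢ + 0) → lincomb c′ (eliminate w i₀) ≈ₚ 0ₚ →
                ∃ λ c → (∃ λ i → c i ≢ + 0) × lincomb c w ≈ₚ 0ₚ
lift-relation w i₀ a≢0 c′ (k₀ , c′k₀≢0) Σc′w′≈0 = c , (punchIn i₀ k₀ , ck₀≢0) , Σcw≈0
  where
  a : ℤ
  a = w i₀ zero
  u : Fin _ → Pt _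
  u k = w (punchIn i₀ k)
  s : ℤ
  s = sum (λ k → c′ k * u k zero)
  c : Fin _ → ℤ
  c = insertAt (λ k → a * c′ k) i₀ (- s)
  ck₀≢0 : c (punchIn i₀ k₀) ≢ + 0
  ck₀≢0 ck₀≡0 with ℤP.i*j≡0⇒i≡0∨j≡0 a (trans (sym (insertAt-punchIn _ i₀ (- s) k₀)) ck₀≡0)
  ... | inj₁ a≡0    = a≢0 a≡0
  ... | inj₂ c′k₀≡0 = c′k₀≢0 c′k₀≡0
  Σcw : ∀ r → lincomb c w r ≡ - s * w i₀ r + a * sum (λ k → c′ k * u k r)
  Σcw r = begin
    lincomb c w r                                   ≡⟨ lincomb-insertAt (λ k → a * c′ k) i₀ (- s) w r ⟩
    - s * w i₀ r + sum (λ k → a * c′ k * u k r)     ≡⟨ cong (_+_ (- s * w i₀ r)) (trans (sum-cong-≗ (λ k → ℤP.*-assoc a (c′ k) (u k r)))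
                                                                                      (sym (*-distribˡ-sum a (λ k → c′ k * u k r)))) ⟩
    - s * w i₀ r + a * sum (λ k → c′ k * u k r)     ∎
  Σcw≈0 : lincomb c w ≈ₚ 0ₚ
  Σcw≈0 zero    = trans (Σcw zero) (-s*a+a*s≡0 s a)
    where
    -s*a+a*s≡0 : ∀ (s a : ℤ) → - s * a + a * s ≡ + 0
    -s*a+a*s≡0 = solve-∀
  Σcw≈0 (suc r) = begin
    lincomb c w (suc r)                                         ≡⟨ Σcw (suc r) ⟩
    - s * w i₀ (suc r) + a * sum (λ k → c′ k * u k (suc r))     ≡⟨ -x*y+z≡z-x*y s (w i₀ (suc r)) _ ⟩
    a * sum (λ k → c′ k * u k (suc r)) - s * w i₀ (suc r)       ≡⟨ ∑-linear a (w i₀ (suc r)) (λ k → c′ k * u k (suc r)) (λ k → c′ k * u k zero) ⟨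
    sum (λ k → a * (c′ k * u k (suc r)) - c′ k * u k zero * w i₀ (suc r))
                                                                ≡⟨ sum-cong-≗ (λ k → distribute (c′ k) a (u k (suc r)) (u k zero) (w i₀ (suc r))) ⟩
    lincomb c′ (eliminate w i₀) r                               ≡⟨ Σc′w′≈0 r ⟩
    + 0                                                         ∎
    where
    -x*y+z≡z-x*y : ∀ (x y z : ℤ) → - x * y + z ≡ z - x * y
    -x*y+z≡z-x*y = solve-∀
    distribute : ∀ (c a p q s : ℤ) → a * (c * p) - c * q * s ≡ c * (a * p - q * s)
    distribute = solve-∀

dependent : n ℕ.< m → (w : Fin m → Pt n) → ∃ λ c → (∃ λ i → c i ≢ + 0) × lincomb c w ≈ₚ 0ₚ
dependent {zero} {suc m} _ w = (λ _ → + 1) , (zero , λ ()) , λ ()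
dependent {suc n} {suc m} (ℕ.s≤s n<m) w with FinP.any? (λ i → ¬? (w i zero ℤ.≟ + 0))
... | yes (i₀ , a≢0) with c′ , nontrivial , Σc′w′≈0 ← dependent n<m (eliminate w i₀) =
  lift-relation w i₀ a≢0 c′ nontrivial Σc′w′≈0
... | no none with c , nontrivial , Σcw≈0 ← dependent (ℕP.m<n⇒m<1+n n<m) (λ i r → w i (suc r)) =
  c , nontrivial , λ { zero → first-coordinate ; (suc r) → Σcw≈0 r }
  where
  first-coordinate : lincomb c w zero ≡ + 0
  first-coordinate = sum-zero _ (λ j → trans (cong (c j *_) (decidable-stable (w j zero ℤ.≟ + 0) (λ ne → none (j , ne))))
                                              (ℤP.*-zeroʳ (c j)))

rational-span : {w : Fin n → Pt n} → LinearlyIndependent w →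
                ∀ x → ∃₂ λ N β → N ≢ + 0 × N *ₚ x ≈ₚ lincomb β w
rational-span {n} {w} independent x with dependent (ℕP.n<1+n n) (x ∷ w)
... | c , (i , cᵢ≢0) , Σcw≈0 with c zero ℤ.≟ + 0
...   | yes c₀≡0 = ⊥-elim (cᵢ≢0 (all-zero i))
  where
  all-zero : ∀ i → c i ≡ + 0
  all-zero zero    = c₀≡0
  all-zero (suc k) = independent (c ∘ suc)
    (λ r → trans (sym (trans (cong (λ t → t * x r + lincomb (c ∘ suc) w r) c₀≡0) (ℤP.+-identityˡ _))) (Σcw≈0 r)) k
...   | no c₀≢0 = c zero , (λ k → - c (suc k)) , c₀≢0 , λ r → begin
  c zero * x r                               ≡⟨ inverseˡ-unique _ _ (Σcw≈0 r) ⟩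
  - lincomb (c ∘ suc) w r                    ≡⟨ sum-neg (λ k → c (suc k) * w k r) ⟨
  sum (λ k → - (c (suc k) * w k r))          ≡⟨ sum-cong-≗ (λ k → ℤP.neg-distribˡ-* (c (suc k)) (w k r)) ⟩
  lincomb (λ k → - c (suc k)) w r            ∎

infix 4 _∣ₚ_

_∣ₚ_ : ℤ → Pt n → Set
t ∣ₚ x = ∀ r → t ℤD.∣ x r

quotientₚ : {t : ℤ} {x : Pt n} → t ∣ₚ x → Pt n
quotientₚ t∣x r = ℤD.quotient (t∣x r)

≈quotientₚ : {t : ℤ} {x : Pt n} (t∣x : t ∣ₚ x) → x ≈ₚ t *ₚ quotientₚ t∣x
≈quotientₚ {t = t} t∣x r = trans (ℤD._∣_.equality (t∣x r)) (ℤP.*-comm (quotientₚ t∣x r) t)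

∣ₚ-resp-≈ₚ : {t : ℤ} {x y : Pt n} → x ≈ₚ y → t ∣ₚ x → t ∣ₚ y
∣ₚ-resp-≈ₚ x≈y t∣x r = subst (_ ℤD.∣_) (x≈y r) (t∣x r)

·V-∣ₚ : (A : Mat n) {t : ℤ} {x : Pt n} → t ∣ₚ x → t ∣ₚ (A ·V x)
·V-∣ₚ A {t} {x} t∣x r = divides ((A ·V quotientₚ t∣x) r) (begin
  (A ·V x) r                      ≡⟨ ·V-cong A (≈quotientₚ t∣x) r ⟩
  (A ·V (t *ₚ quotientₚ t∣x)) r   ≡⟨ ·V-*ₚ A t (quotientₚ t∣x) r ⟩
  t * (A ·V quotientₚ t∣x) r      ≡⟨ ℤP.*-comm t _ ⟩
  (A ·V quotientₚ t∣x) r * t      ∎)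

∣-sum : {d : ℤ} (f : Fin n → ℤ) → (∀ i → d ℤD.∣ f i) → d ℤD.∣ sum f
∣-sum {zero}  {d} f d∣f = divides (+ 0) (sym (ℤP.*-zeroˡ d))
∣-sum {suc n}     f d∣f = ℤD.∣m∣n⇒∣m+n (d∣f zero) (∣-sum (f ∘ suc) (d∣f ∘ suc))

-- By Bézout, Primitive x says that the coordinates of x are coprime.
Primitive : Pt n → Set
Primitive {n} x = ∃ λ (φ : Pt n) → sum (λ r → φ r * x r) ≡ + 1

primitive-∣ : {x w : Pt n} {N k : ℤ} → Primitive x → N *ₚ w ≈ₚ k *ₚ x → N ℤD.∣ k
primitive-∣ {x = x} {w} {N} {k} (φ , φx≡1) Nw≈kx = divides (sum (λ r → φ r * w r)) (begin
  k                                ≡⟨ ℤP.*-identityʳ k ⟨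
  k * + 1                          ≡⟨ cong (k *_) φx≡1 ⟨
  k * sum (λ r → φ r * x r)        ≡⟨ *-distribˡ-sum k (λ r → φ r * x r) ⟩
  sum (λ r → k * (φ r * x r))      ≡⟨ sum-cong-≗ (λ r → trans (x∙yz≈y∙xz k (φ r) (x r)) (cong (φ r *_) (sym (Nw≈kx r)))) ⟩
  sum (λ r → φ r * (N * w r))      ≡⟨ sum-cong-≗ (λ r → x∙yz≈y∙xz (φ r) N (w r)) ⟩
  sum (λ r → N * (φ r * w r))      ≡⟨ *-distribˡ-sum N (λ r → φ r * w r) ⟨
  N * sum (λ r → φ r * w r)        ≡⟨ ℤP.*-comm N _ ⟩
  sum (λ r → φ r * w r) * N        ∎)

primitive-trichotomy : (x : Pt n) → x ≈ₚ 0ₚ ⊎ Primitive x ⊎ ∃ λ t → 2 ≤ t × + t ∣ₚ x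
primitive-trichotomy x with bézout x
... | 0           , 0∣x , _ = inj₁ (λ r → ℤD.0∣⇒≡0 (0∣x r))
... | 1           , _   , φ , 1≡φx = inj₂ (inj₁ (φ , sym 1≡φx))
... | suc (suc t) , t∣x , _ = inj₂ (inj₂ (suc (suc t) , ℕ.s≤s (ℕ.s≤s ℕ.z≤n) , t∣x))

edge : Simplex n → Fin n → Pt n
edge v k = v (suc k) -ₚ v zero

lincomb-vertices : (v : Simplex n) (c : Fin (suc n) → ℤ) →
                   lincomb c v ≈ₚ lincomb (c ∘ suc) (edge v) +ₚ sum c *ₚ v zero
lincomb-vertices v c r = sym (begin
  lincomb (c ∘ suc) (edge v) r + sum c * v zero r
    ≡⟨ cong (_+ sum c * v zero r) (sum-cong-≗ (λ k → *-distribˡ-- (c (suc k)) (v (suc k) r) (v zero r))) ⟩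
  sum (λ k → c (suc k) * v (suc k) r - c (suc k) * v zero r) + sum c * v zero r
    ≡⟨ cong (_+ sum c * v zero r) (∑-distrib-- (λ k → c (suc k) * v (suc k) r) (λ k → c (suc k) * v zero r)) ⟩
  Σcv - sum (λ k → c (suc k) * v zero r) + sum c * v zero r
    ≡⟨ cong (λ t → Σcv - t + sum c * v zero r) (*-distribʳ-sum (v zero r) (c ∘ suc)) ⟨
  Σcv - sum (c ∘ suc) * v zero r + (c zero + sum (c ∘ suc)) * v zero r
    ≡⟨ regroup Σcv (sum (c ∘ suc)) (c zero) (v zero r) ⟩
  c zero * v zero r + Σcv
    ∎)
  where
  Σcv : ℤ
  Σcv = sum (λ k → c (suc k) * v (suc k) r)
  regroup : ∀ (t s c₀ x : ℤ) → t - s * x + (c₀ + s) * x ≡ c₀ * x + t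
  regroup = solve-∀

lincomb-edge : (v : Simplex n) (c : Fin (suc n) → ℤ) → sum c ≡ + 0 → lincomb c v ≈ₚ lincomb (c ∘ suc) (edge v)
lincomb-edge v c Σc≡0 r = begin
  lincomb c v r                                        ≡⟨ lincomb-vertices v c r ⟩
  lincomb (c ∘ suc) (edge v) r + sum c * v zero r      ≡⟨ cong (λ t → lincomb (c ∘ suc) (edge v) r + t * v zero r) Σc≡0 ⟩
  lincomb (c ∘ suc) (edge v) r + + 0                   ≡⟨ ℤP.+-identityʳ _ ⟩
  lincomb (c ∘ suc) (edge v) r                         ∎

simplex⇒independent : {v : Simplex n} → IsSimplex v → LinearlyIndependent (edge v)
simplex⇒independent {v = v} simplex β Σβu≈0 k = simplex c Σc≡0 Σcv≡0 (suc k)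
  where
  c : Fin (suc _) → ℤ
  c = - sum β ∷ β
  Σc≡0 : sumF c ≡ + 0
  Σc≡0 = trans (sumF≡sum c) (ℤP.+-inverseˡ (sum β))
  Σcv≡0 : ∀ r → sumF (λ i → c i * v i r) ≡ + 0
  Σcv≡0 r = trans (sumF≡sum (λ i → c i * v i r)) (trans (lincomb-edge v c (ℤP.+-inverseˡ (sum β)) r) (Σβu≈0 r))

independent⇒simplex : {v : Simplex n} → LinearlyIndependent (edge v) → IsSimplex v
independent⇒simplex {v = v} independent c Σc≡0 Σcv≡0 = c≡0
  where
  Σc≡0′ : sum c ≡ + 0
  Σc≡0′ = trans (sym (sumF≡sum c)) Σc≡0
  c∘suc≡0 : ∀ k → c (suc k) ≡ + 0
  c∘suc≡0 = independent (c ∘ suc) (λ r → trans (sym (lincomb-edge v c Σc≡0′ r)) (trans (sym (sumF≡sum (λ i → c i * v i r))) (Σcv≡0 r)))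
  c≡0 : ∀ i → c i ≡ + 0
  c≡0 zero    = trans (inverseˡ-unique (c zero) (sum (c ∘ suc)) Σc≡0′) (cong -_ (sum-zero (c ∘ suc) c∘suc≡0))
  c≡0 (suc k) = c∘suc≡0 k

simplex-vertices-distinct : {v : Simplex n} → IsSimplex v → ∀ {i j} → v i ≈ₚ v j → i ≡ j
simplex-vertices-distinct {v = v} simplex {i} {j} vᵢ≈vⱼ with i Fin.≟ j
... | yes i≡j = i≡j
... | no i≢j  = ⊥-elim (1≢0 (begin
  + 1                 ≡⟨ cong₂ _-_ (idMat-diag i) (idMat-off (i≢j ∘ sym)) ⟨
  c i                 ≡⟨ simplex c Σc≡0 Σcv≡0 i ⟩
  + 0                 ∎))
  where
  1≢0 : + 1 ≢ + 0
  1≢0 ()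
  c : Fin (suc _) → ℤ
  c k = idMat i k - idMat j k
  select : (f : Fin (suc _) → ℤ) → sum (λ k → c k * f k) ≡ f i - f j
  select f = begin
    sum (λ k → c k * f k)                                    ≡⟨ sum-cong-≗ (λ k → [a-b]*c≡a*c-b*c (idMat i k) (idMat j k) (f k)) ⟩
    sum (λ k → idMat i k * f k - idMat j k * f k)            ≡⟨ ∑-distrib-- (λ k → idMat i k * f k) (λ k → idMat j k * f k) ⟩
    sum (λ k → idMat i k * f k) - sum (λ k → idMat j k * f k) ≡⟨ cong₂ _-_ (sum-idMatˡ f i) (sum-idMatˡ f j) ⟩
    f i - f j                                                ∎
    where
    [a-b]*c≡a*c-b*c : ∀ (a b c : ℤ) → (a - b) * c ≡ a * c - b * c
    [a-b]*c≡a*c-b*c = solve-∀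
  Σc≡0 : sumF c ≡ + 0
  Σc≡0 = trans (sumF≡sum c) (trans (sum-cong-≗ (λ k → sym (ℤP.*-identityʳ (c k)))) (trans (select (λ _ → + 1)) (ℤP.+-inverseʳ (+ 1))))
  Σcv≡0 : ∀ r → sumF (λ k → c k * v k r) ≡ + 0
  Σcv≡0 r = trans (sumF≡sum (λ k → c k * v k r)) (trans (select (λ k → v k r)) (ℤP.i≡j⇒i-j≡0 (vᵢ≈vⱼ r)))

IsSimplex-permute : {v : Simplex n} → IsSimplex v → (σ : Permutation′ (suc n)) → IsSimplex (v ∘ (σ ⟨$⟩ʳ_))
IsSimplex-permute {v = v} simplex σ c Σc≡0 Σcvσ≡0 i = trans (cong c (sym (Perm.inverseˡ σ {i}))) (simplex c′ Σc′≡0 Σc′v≡0 (σ ⟨$⟩ʳ i))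
  where
  c′ : Fin (suc _) → ℤ
  c′ j = c (σ ⟨$⟩ˡ j)
  permute : (f : Fin (suc _) → ℤ) → sumF (λ j → f (σ ⟨$⟩ˡ j)) ≡ sumF f
  permute f = begin
    sumF (λ j → f (σ ⟨$⟩ˡ j))                ≡⟨ sumF≡sum (λ j → f (σ ⟨$⟩ˡ j)) ⟩
    sum (λ j → f (σ ⟨$⟩ˡ j))                 ≡⟨ sum-permute (λ j → f (σ ⟨$⟩ˡ j)) σ ⟩
    sum (λ i → f (σ ⟨$⟩ˡ (σ ⟨$⟩ʳ i)))        ≡⟨ sum-cong-≗ (λ i → cong f (Perm.inverseˡ σ {i})) ⟩
    sum f                                    ≡⟨ sumF≡sum f ⟨
    sumF f                                   ∎
  Σc′≡0 : sumF c′ ≡ + 0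
  Σc′≡0 = trans (permute c) Σc≡0
  Σc′v≡0 : ∀ r → sumF (λ j → c′ j * v j r) ≡ + 0
  Σc′v≡0 r = begin
    sumF (λ j → c′ j * v j r)                          ≡⟨ sumF≡sum (λ j → c′ j * v j r) ⟩
    sum (λ j → c′ j * v j r)                           ≡⟨ sum-cong-≗ (λ j → cong (λ k → c′ j * v k r) (Perm.inverseʳ σ {j})) ⟨
    sum (λ j → c′ j * v (σ ⟨$⟩ʳ (σ ⟨$⟩ˡ j)) r)          ≡⟨ sumF≡sum (λ j → c′ j * v (σ ⟨$⟩ʳ (σ ⟨$⟩ˡ j)) r) ⟨
    sumF (λ j → c′ j * v (σ ⟨$⟩ʳ (σ ⟨$⟩ˡ j)) r)         ≡⟨ permute (λ i → c i * v (σ ⟨$⟩ʳ i) r) ⟩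
    sumF (λ i → c i * v (σ ⟨$⟩ʳ i) r)                  ≡⟨ Σcvσ≡0 r ⟩
    + 0                                                ∎

multiple⇒edges-divisible : {v : Simplex n} {t a : ℕ} {q : Fin a → Pt n} (f : LatticeAffine n) →
                           (∀ i → ∃[ j ] (apply f (v i) ≈ₚ multiple t q j)) → ∀ k → + t ∣ₚ edge v k
multiple⇒edges-divisible {v = v} {t} {q = q} f v→tq k
  with j , fvₖ≈tqⱼ ← v→tq (suc k) | j₀ , fv₀≈tqⱼ₀ ← v→tq zero =
  ∣ₚ-resp-≈ₚ (A⁻¹-·V-A f (edge v k)) (·V-∣ₚ (LatticeAffine.A⁻¹ f) t∣A·edge)
  where
  t∣A·edge : + t ∣ₚ (LatticeAffine.A f ·V edge v k)
  t∣A·edge r = divides (q j r - q j₀ r) (begin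
    (LatticeAffine.A f ·V edge v k) r            ≡⟨ apply-diff f (v (suc k)) (v zero) r ⟨
    apply f (v (suc k)) r - apply f (v zero) r   ≡⟨ cong₂ _-_ (fvₖ≈tqⱼ r) (fv₀≈tqⱼ₀ r) ⟩
    + t * q j r - + t * q j₀ r                   ≡⟨ t*a-t*b≡[a-b]*t (+ t) (q j r) (q j₀ r) ⟩
    (q j r - q j₀ r) * + t                       ∎)
    where
    t*a-t*b≡[a-b]*t : ∀ (t a b : ℤ) → t * a - t * b ≡ (a - b) * t
    t*a-t*b≡[a-b]*t = solve-∀

-- Translating v₀ to the origin exhibits v as the t-multiple of the simplex with edges edge v k / t.
edges-divisible⇒¬elementary : {v : Simplex n} {t : ℕ} → 2 ≤ t → (∀ k → + t ∣ₚ edge v k) → ¬ Elementary v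
edges-divisible⇒¬elementary {n} {v} {t} 2≤t t∣edge elementary =
  elementary (t , 2≤t , suc n , q , translation (ℤ.-1ℤ *ₚ v zero) , (λ i → i , v↦tq i) , (λ i → i , v↦tq i))
  where
  q : Simplex n
  q zero    = 0ₚ
  q (suc k) = quotientₚ (t∣edge k)
  v↦tq : ∀ i → apply (translation (ℤ.-1ℤ *ₚ v zero)) (v i) ≈ₚ multiple t q i
  v↦tq i r = trans (apply-translation (ℤ.-1ℤ *ₚ v zero) (v i) r) (trans (cong (_+_ (v i r)) (ℤP.-1*i≡-i (v zero r))) (translated i))
    where
    translated : ∀ i → v i r - v zero r ≡ multiple t q i r
    translated zero    = trans (ℤP.+-inverseʳ (v zero r)) (sym (ℤP.*-zeroʳ (+ t)))
    translated (suc k) = ≈quotientₚ (t∣edge k) r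

primitive-edge⇒elementary : {v : Simplex n} (k : Fin n) → Primitive (edge v k) → Elementary v
primitive-edge⇒elementary {v = v} k edge-primitive (t , 2≤t , a , q , f , v→tq , _) =
  ℕP.<-irrefl refl (ℕP.≤-trans 2≤t (ℕP.≤-reflexive (ℕD.∣1⇒≡1 t∣1)))
  where
  t∣edge : + t ∣ₚ edge v k
  t∣edge = multiple⇒edges-divisible {v = v} {t = t} f v→tq k
  t∣1 : t ∣ 1
  t∣1 = ∣⇒∣ᵤ (primitive-∣ {w = quotientₚ t∣edge} {N = + t} {k = + 1} edge-primitive
    (λ r → trans (sym (≈quotientₚ t∣edge r)) (sym (ℤP.*-identityˡ (edge v k r)))))

-- Flags and regularity

indicator : Bool → ℕ
indicator b = if b then 1 else 0

∣tabulate∣ : (f : Fin k → Bool) → ∣ tabulate f ∣ ≡ Σℕ.sum (indicator ∘ f)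
∣tabulate∣ {zero}  f = refl
∣tabulate∣ {suc k} f with f zero
... | true  = cong suc (∣tabulate∣ (f ∘ suc))
... | false = ∣tabulate∣ (f ∘ suc)

∑-initial-segment : ∀ N d → d ℕ.< N → Σℕ.sum (λ (y : Fin N) → indicator (toℕ y ℕ.<ᵇ suc d)) ≡ suc d
∑-initial-segment (suc N) zero    _           = cong suc (Σℕ.sum-replicate-zero N)
∑-initial-segment (suc N) (suc d) (ℕ.s≤s d<N) = cong suc (∑-initial-segment N d d<N)

∈-tabulate : (f : Fin k → Bool) (x : Fin k) → x ∈ tabulate f ⇔ T (f x)
∈-tabulate f x = mk⇔
  (λ x∈ → from T-≡ (trans (sym (VecP.lookup∘tabulate f x)) (VecP.[]=⇒lookup x∈)))
  (λ t → VecP.lookup⇒[]= x (tabulate f) (trans (VecP.lookup∘tabulate f x) (to T-≡ t)))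

two-outside : {P Q : Subset k} {x y : Fin k} → P ⊆ Q → x ∈ Q → y ∈ Q → x ∉ P → y ∉ P → x ≢ y →
              2 ℕ.+ ∣ P ∣ ≤ ∣ Q ∣
two-outside {P = P} {Q} {x} {y} P⊆Q x∈Q y∈Q x∉P y∉P x≢y =
  ℕP.≤-trans (ℕ.s≤s (p⊂q⇒∣p∣<∣q∣ (P⊆Q-y , x , x∈p∧x≢y⇒x∈p-y x∈Q x≢y , x∉P))) (x∈p⇒∣p-x∣<∣p∣ y∈Q)
  where
  P⊆Q-y : P ⊆ Q Subset.- y
  P⊆Q-y z∈P = x∈p∧x≢y⇒x∈p-y (P⊆Q z∈P) (λ { refl → y∉P z∈P })

Ranks : Permutation′ (suc n) → Flag n → Set
Ranks π Φ = ∀ d x → x ∈ Flag.F Φ d ⇔ toℕ (π ⟨$⟩ʳ x) ≤ toℕ d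

rankedFace : Permutation′ (suc n) → Fin (suc n) → Subset (suc n)
rankedFace π d = tabulate (λ x → toℕ (π ⟨$⟩ʳ x) ℕ.<ᵇ suc (toℕ d))

∈-rankedFace : (π : Permutation′ (suc n)) (d x : Fin (suc n)) → x ∈ rankedFace π d ⇔ toℕ (π ⟨$⟩ʳ x) ≤ toℕ d
∈-rankedFace π d x = mk⇔
  (ℕ.s≤s⁻¹ ∘ ℕP.<ᵇ⇒< _ _ ∘ to (∈-tabulate rank≤d x))
  (from (∈-tabulate rank≤d x) ∘ ℕP.<⇒<ᵇ ∘ ℕ.s≤s)
  where
  rank≤d : Fin _ → Bool
  rank≤d y = toℕ (π ⟨$⟩ʳ y) ℕ.<ᵇ suc (toℕ d)

∣rankedFace∣ : (π : Permutation′ (suc n)) (d : Fin (suc n)) → ∣ rankedFace π d ∣ ≡ suc (toℕ d)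
∣rankedFace∣ {n} π d = begin
  ∣ rankedFace π d ∣                                        ≡⟨ ∣tabulate∣ (λ x → toℕ (π ⟨$⟩ʳ x) ℕ.<ᵇ suc (toℕ d)) ⟩
  Σℕ.sum (λ x → indicator (toℕ (π ⟨$⟩ʳ x) ℕ.<ᵇ suc (toℕ d))) ≡⟨ Σℕ.sum-permute (λ (y : Fin (suc n)) → indicator (toℕ y ℕ.<ᵇ suc (toℕ d))) π ⟨
  Σℕ.sum (λ (y : Fin (suc n)) → indicator (toℕ y ℕ.<ᵇ suc (toℕ d)))          ≡⟨ ∑-initial-segment (suc n) (toℕ d) (FinP.toℕ<n d) ⟩
  suc (toℕ d)                                               ∎

rankedFlag : Permutation′ (suc n) → Flag n
rankedFlag π = record
  { F      = rankedFace π
  ; card   = ∣rankedFace∣ π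
  ; nested = λ d {x} x∈ → from (∈-rankedFace π (suc d) x)
      (ℕP.m≤n⇒m≤1+n (subst (toℕ (π ⟨$⟩ʳ x) ≤_) (FinP.toℕ-inject₁ d) (to (∈-rankedFace π (inject₁ d) x) x∈)))
  }

rankedFlag-ranks : (π : Permutation′ (suc n)) → Ranks π (rankedFlag π)
rankedFlag-ranks = ∈-rankedFace

least : {P : Fin k → Set} → Decidable P → ∃ P → ∃ λ d → P d × (∀ d′ → toℕ d′ ℕ.< toℕ d → ¬ P d′)
least {suc k} P? (w , Pw) with P? zero
... | yes P0 = zero , P0 , λ _ ()
... | no ¬P0 with w | Pw
...   | zero   | P0  = ⊥-elim (¬P0 P0)
...   | suc w′ | Pw′ with least (P? ∘ suc) (w′ , Pw′)
...     | d , Pd , below = suc d , Pd , λ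
  { zero     _           → ¬P0
  ; (suc d′) (ℕ.s≤s d′<d) → below d′ d′<d }

injective⇒surjective : {f : Fin k → Fin k} → (∀ {x y} → f x ≡ f y → x ≡ y) → ∀ y → ∃ λ x → f x ≡ y
injective⇒surjective {suc k} {f} f-inj y with FinP.any? (λ x → f x Fin.≟ y)
... | yes found = found
... | no missed = ⊥-elim (ℕP.<-irrefl refl (FinP.injective⇒≤ g-inj))
  where
  y≢f : ∀ x → y ≢ f x
  y≢f x y≡fx = missed (x , sym y≡fx)
  g : Fin (suc k) → Fin k
  g x = punchOut (y≢f x)
  g-inj : ∀ {a b} → g a ≡ g b → a ≡ b
  g-inj {a} {b} = f-inj ∘ FinP.punchOut-injective (y≢f a) (y≢f b)

injective⇒permutation : (f : Fin k → Fin k) → (∀ {x y} → f x ≡ f y → x ≡ y) → Permutation′ k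
injective⇒permutation f f-inj = Perm.permutation f (proj₁ ∘ onto) (proj₂ ∘ onto) (λ x → f-inj (proj₂ (onto (f x))))
  where
  onto : ∀ y → ∃ λ x → f x ≡ y
  onto = injective⇒surjective f-inj

module _ (Φ : Flag n) where
  open Flag Φ

  private
    F-mono′ : ∀ k {d d′} → toℕ d′ ≡ k ℕ.+ toℕ d → F d ⊆ F d′
    F-mono′ zero    {d} {d′}     d′≡d   = subst (λ e → F d ⊆ F e) (FinP.toℕ-injective (sym d′≡d)) id
    F-mono′ (suc k) {d} {suc d′} d′≡k+d = nested d′ ∘ F-mono′ k (trans (FinP.toℕ-inject₁ d′) (ℕP.suc-injective d′≡k+d))

  F-mono : ∀ {d d′} → toℕ d ≤ toℕ d′ → F d ⊆ F d′
  F-mono {d} {d′} d≤d′ = F-mono′ (toℕ d′ ℕ.∸ toℕ d) (sym (ℕP.m∸n+n≡m d≤d′))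

  ∈-top : ∀ x → x ∈ F (fromℕ n)
  ∈-top x = subst (x ∈_) (sym (∣p∣≡n⇒p≡⊤ (trans (card (fromℕ n)) (cong suc (FinP.toℕ-fromℕ n))))) ∈⊤

  Enters : Fin (suc n) → Fin (suc n) → Set
  Enters x d = x ∈ F d × (∀ d′ → toℕ d′ ℕ.< toℕ d → x ∉ F d′)

  -- Two vertices cannot enter at the same dimension: the faces would grow by two.
  enters-unique : ∀ {x y d} → Enters x d → Enters y d → x ≡ y
  enters-unique {x} {y} {d} x-enters y-enters with x Fin.≟ y
  ... | yes x≡y = x≡y
  ... | no x≢y  = ⊥-elim (impossible d x-enters y-enters)
    where
    impossible : ∀ d → Enters x d → Enters y d → ⊥
    impossible zero (x∈ , _) (y∈ , _) = 2≰1 (subst₂ _≤_ (cong (2 ℕ.+_) (∣⊥∣≡0 (suc n))) (card zero)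
      (two-outside {P = Subset.⊥} (⊥-elim ∘ ∉⊥) x∈ y∈ ∉⊥ ∉⊥ x≢y))
      where
      2≰1 : ¬ (2 ≤ 1)
      2≰1 (ℕ.s≤s ())
    impossible (suc d) (x∈ , x-new) (y∈ , y-new) =
      ℕP.1+n≰n (ℕ.s≤s⁻¹ (ℕ.s≤s⁻¹ (subst₂ _≤_
        (trans (cong (2 ℕ.+_) (card (inject₁ d))) (cong (3 ℕ.+_) (FinP.toℕ-inject₁ d))) (card (suc d)) two-more)))
      where
      earlier : toℕ (inject₁ d) ℕ.< toℕ (suc d)
      earlier = ℕ.s≤s (ℕP.≤-reflexive (FinP.toℕ-inject₁ d))
      two-more : 2 ℕ.+ ∣ F (inject₁ d) ∣ ≤ ∣ F (suc d) ∣
      two-more = two-outside (nested d) x∈ y∈ (x-new _ earlier) (y-new _ earlier) x≢y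

  rank : Fin (suc n) → Fin (suc n)
  rank x = proj₁ (least (λ d → x SubsetP.∈? F d) (fromℕ n , ∈-top x))

  rank-enters : ∀ x → Enters x (rank x)
  rank-enters x = proj₂ (least (λ d → x SubsetP.∈? F d) (fromℕ n , ∈-top x))

  rank-injective : ∀ {x y} → rank x ≡ rank y → x ≡ y
  rank-injective {x} {y} rx≡ry = enters-unique (rank-enters x) (subst (Enters y) (sym rx≡ry) (rank-enters y))

  flag-ranked : ∃ λ π → Ranks π Φ
  flag-ranked = injective⇒permutation rank rank-injective , λ d x → mk⇔
    (λ x∈ → ℕP.≮⇒≥ (λ d<rank → proj₂ (rank-enters x) d d<rank x∈))
    (λ rank≤d → F-mono rank≤d (proj₁ (rank-enters x)))

FullySymmetric : Simplex n → Set
FullySymmetric {n} v = (σ : Permutation′ (suc n)) → ∃ λ f → ∀ i → apply f (v i) ≈ₚ v (σ ⟨$⟩ʳ i)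

flag-map-permutes : {v : Simplex n} → IsSimplex v → {Φ Ψ : Flag n} {π ρ : Permutation′ (suc n)} →
                    Ranks π Φ → Ranks ρ Ψ → (f : LatticeAffine n) →
                    (∀ d → MapsFace f v (Flag.F Φ d) (Flag.F Ψ d)) →
                    ∀ x → apply f (v x) ≈ₚ v (ρ ⟨$⟩ˡ (π ⟨$⟩ʳ x))
flag-map-permutes {n = n} {v = v} simplex {π = π} {ρ} πΦ ρΨ f faces x
  with j , j∈Ψ , fx≈vj ← proj₁ (faces (π ⟨$⟩ʳ x)) x (from (πΦ _ x) ℕP.≤-refl) =
  λ r → trans (fx≈vj r) (cong (λ i → v i r) j≡)
  where
  d : Fin (suc n)
  d = π ⟨$⟩ʳ x
  ρj≤d : toℕ (ρ ⟨$⟩ʳ j) ≤ toℕ d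
  ρj≤d = to (ρΨ d j) j∈Ψ
  ρj≮d : ¬ (toℕ (ρ ⟨$⟩ʳ j) ℕ.< toℕ d)
  ρj≮d ρj<d with proj₂ (faces (ρ ⟨$⟩ʳ j)) j (from (ρΨ _ j) ℕP.≤-refl)
  ... | i , i∈Φ , fi≈vj = ℕP.<⇒≱ ρj<d (subst (λ y → toℕ (π ⟨$⟩ʳ y) ≤ _) i≡x (to (πΦ _ i) i∈Φ))
    where
    i≡x : i ≡ x
    i≡x = simplex-vertices-distinct simplex (apply-injective f (λ r → trans (fi≈vj r) (sym (fx≈vj r))))
  j≡ : j ≡ ρ ⟨$⟩ˡ d
  j≡ = trans (sym (Perm.inverseˡ ρ)) (cong (ρ ⟨$⟩ˡ_) (FinP.toℕ-injective (ℕP.≤-antisym ρj≤d (ℕP.≮⇒≥ ρj≮d))))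

regular⇒fullySymmetric : {v : Simplex n} → IsSimplex v → LatticeRegular v → FullySymmetric v
regular⇒fullySymmetric {n} {v} simplex regular σ =
  f , flag-map-permutes simplex {rankedFlag ι} {rankedFlag (Perm.flip σ)} {ι} {Perm.flip σ} (rankedFlag-ranks ι) (rankedFlag-ranks (Perm.flip σ)) f faces
  where
  ι : Permutation′ (suc n)
  ι = Perm.id
  f : LatticeAffine n
  f = proj₁ (regular (rankedFlag ι) (rankedFlag (Perm.flip σ)))
  faces : ∀ d → MapsFace f v (Flag.F (rankedFlag ι) d) (Flag.F (rankedFlag (Perm.flip σ)) d)
  faces = proj₂ (proj₂ (regular (rankedFlag ι) (rankedFlag (Perm.flip σ))))

fullySymmetric⇒regular : {v : Simplex n} → FullySymmetric v → LatticeRegular v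
fullySymmetric⇒regular {n = n} {v = v} symmetric Φ Ψ with flag-ranked Φ | flag-ranked Ψ
... | π , πΦ | ρ , ρΨ with symmetric (π ∘ₚ Perm.flip ρ)
...   | f , f-realises = f , (onto , into) , faces
  where
  σ : Permutation′ (suc n)
  σ = π ∘ₚ Perm.flip ρ
  f-realises⁻¹ : ∀ j → apply f (v (σ ⟨$⟩ˡ j)) ≈ₚ v j
  f-realises⁻¹ j r = trans (f-realises (σ ⟨$⟩ˡ j) r) (cong (λ i → v i r) (Perm.inverseʳ σ))
  onto : ∀ i → ∃[ j ] (apply f (v i) ≈ₚ v j)
  onto i = σ ⟨$⟩ʳ i , f-realises i
  into : ∀ j → ∃[ i ] (apply f (v i) ≈ₚ v j)
  into j = σ ⟨$⟩ˡ j , f-realises⁻¹ j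
  faces : ∀ d → MapsFace f v (Flag.F Φ d) (Flag.F Ψ d)
  faces d = (λ i i∈Φ → σ ⟨$⟩ʳ i , from (ρΨ d _) (subst (_≤ toℕ d) (cong toℕ (sym (Perm.inverseʳ ρ))) (to (πΦ d i) i∈Φ)) , f-realises i)
          , (λ j j∈Ψ → σ ⟨$⟩ˡ j , from (πΦ d _) (subst (_≤ toℕ d) (cong toℕ (sym (Perm.inverseʳ π))) (to (ρΨ d j) j∈Ψ)) , f-realises⁻¹ j)

-- The simplices Sⁿₚ

last : Fin (suc m)
last {m} = fromℕ m

S-suc : (p : ℕ) (k j : Fin (suc m)) → S (suc m) p (suc k) j ≡ idMat k j + (+ p - + 1) * idMat k last
S-suc {m} p k j with suc (toℕ k) ℕ.≟ suc m | suc (toℕ j) ℕ.≟ suc m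
... | no k≢last | _ = sym (begin
  idMat k j + (+ p - + 1) * idMat k last  ≡⟨ cong (λ t → idMat k j + (+ p - + 1) * t) (idMat-off (k≢last ∘ last⇒)) ⟩
  idMat k j + (+ p - + 1) * + 0           ≡⟨ x+y*0≡x (idMat k j) (+ p - + 1) ⟩
  idMat k j                               ∎)
  where
  last⇒ : k ≡ last → suc (toℕ k) ≡ suc m
  last⇒ refl = cong suc (FinP.toℕ-fromℕ m)
  x+y*0≡x : ∀ (x y : ℤ) → x + y * + 0 ≡ x
  x+y*0≡x = solve-∀
... | yes k-last | yes j-last = sym (begin
  idMat k j + (+ p - + 1) * idMat k last  ≡⟨ cong₂ (λ s t → s + (+ p - + 1) * t) (idMat-≡ (trans (⇒last k-last) (sym (⇒last j-last)))) (idMat-≡ (⇒last k-last)) ⟩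
  + 1 + (+ p - + 1) * + 1                 ≡⟨ 1+[p-1]*1≡p (+ p) ⟩
  + p                                     ∎)
  where
  ⇒last : ∀ {i : Fin (suc m)} → suc (toℕ i) ≡ suc m → i ≡ last
  ⇒last e = FinP.toℕ-injective (trans (ℕP.suc-injective e) (sym (FinP.toℕ-fromℕ m)))
  1+[p-1]*1≡p : ∀ (p : ℤ) → + 1 + (p - + 1) * + 1 ≡ p
  1+[p-1]*1≡p = solve-∀
... | yes k-last | no j≢last = sym (begin
  idMat k j + (+ p - + 1) * idMat k last  ≡⟨ cong₂ (λ s t → s + (+ p - + 1) * t) (idMat-off k≢j) (idMat-≡ (⇒last k-last)) ⟩
  + 0 + (+ p - + 1) * + 1                 ≡⟨ 0+x*1≡x (+ p - + 1) ⟩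
  + p - + 1                               ∎)
  where
  ⇒last : ∀ {i : Fin (suc m)} → suc (toℕ i) ≡ suc m → i ≡ last
  ⇒last e = FinP.toℕ-injective (trans (ℕP.suc-injective e) (sym (FinP.toℕ-fromℕ m)))
  k≢j : k ≢ j
  k≢j refl = j≢last k-last
  0+x*1≡x : ∀ (x : ℤ) → + 0 + x * + 1 ≡ x
  0+x*1≡x = solve-∀

edge-S : (p : ℕ) (k : Fin n) → edge (S n p) k ≈ₚ S n p (suc k)
edge-S p k r = ℤP.+-identityʳ (S _ p (suc k) r)

lincomb-S : (p : ℕ) (c : Fin (suc m) → ℤ) → lincomb c (edge (S (suc m) p)) ≈ₚ c +ₚ ((+ p - + 1) * c last) *ₚ 𝟙
lincomb-S p c r = begin
  sum (λ k → c k * edge (S _ p) k r)                                      ≡⟨ sum-cong-≗ (λ k → cong (c k *_) (trans (edge-S p k r) (S-suc p k r))) ⟩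
  sum (λ k → c k * (idMat k r + (+ p - + 1) * idMat k last))              ≡⟨ sum-cong-≗ (λ k → distribute (c k) (idMat k r) (+ p - + 1) (idMat k last)) ⟩
  sum (λ k → c k * idMat k r + (+ p - + 1) * (c k * idMat k last))        ≡⟨ ∑-distrib-+ (λ k → c k * idMat k r) (λ k → (+ p - + 1) * (c k * idMat k last)) ⟩
  sum (λ k → c k * idMat k r) + sum (λ k → (+ p - + 1) * (c k * idMat k last))
                                                                          ≡⟨ cong₂ _+_ (sum-idMat c r)
                                                                               (trans (sym (*-distribˡ-sum (+ p - + 1) (λ k → c k * idMat k last)))
                                                                                      (cong ((+ p - + 1) *_) (sum-idMat c last))) ⟩
  c r + (+ p - + 1) * c last                                              ≡⟨ cong (_+_ (c r)) (ℤP.*-identityʳ _) ⟨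
  c r + (+ p - + 1) * c last * + 1                                        ∎
  where
  distribute : ∀ (c a t b : ℤ) → c * (a + t * b) ≡ c * a + t * (c * b)
  distribute = solve-∀

S-independent : (p : ℕ) → 1 ≤ p → LinearlyIndependent (edge (S (suc m) p))
S-independent p 1≤p c Σcu≈0 r = begin
  c r                                                          ≡⟨ x≡x+t-t (c r) (t (c last)) ⟩
  c r + t (c last) - t (c last)                                ≡⟨ cong₂ _-_ (trans (sym (lincomb-S p c r)) (Σcu≈0 r)) (cong t c-last≡0) ⟩
  + 0 - t (+ 0)                                                ≡⟨ 0-[p-1]*0*1≡0 (+ p) ⟩
  + 0                                                          ∎
  where
  t : ℤ → ℤ
  t y = (+ p - + 1) * y * + 1
  x≡x+t-t : ∀ (x t : ℤ) → x ≡ x + t - t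
  x≡x+t-t = solve-∀
  0-[p-1]*0*1≡0 : ∀ (p : ℤ) → + 0 - (p - + 1) * + 0 * + 1 ≡ + 0
  0-[p-1]*0*1≡0 = solve-∀
  p*c-last≡0 : + p * c last ≡ + 0
  p*c-last≡0 = trans (p*y≡y+[p-1]*y*1 (+ p) (c last)) (trans (sym (lincomb-S p c last)) (Σcu≈0 last))
    where
    p*y≡y+[p-1]*y*1 : ∀ (p y : ℤ) → p * y ≡ y + (p - + 1) * y * + 1
    p*y≡y+[p-1]*y*1 = solve-∀
  c-last≡0 : c last ≡ + 0
  c-last≡0 with ℤP.i*j≡0⇒i≡0∨j≡0 (+ p) p*c-last≡0
  ... | inj₁ p≡0 = ⊥-elim (ℕP.1+n≰n (ℕP.≤-trans 1≤p (ℕP.≤-reflexive (ℤP.+-injective p≡0))))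
  ... | inj₂ c-last≡0 = c-last≡0

S-scaled-span : (p : ℕ) (x : Pt (suc m)) →
                (+ p) *ₚ x ≈ₚ lincomb ((+ p) *ₚ x -ₚ ((+ p - + 1) * x last) *ₚ 𝟙) (edge (S (suc m) p))
S-scaled-span p x r = sym (trans (lincomb-S p ((+ p) *ₚ x -ₚ ((+ p - + 1) * x last) *ₚ 𝟙) r) (cancel (+ p) (x r) (x last)))
  where
  cancel : ∀ (p y z : ℤ) → p * y - (p - + 1) * z * + 1 + (p - + 1) * (p * z - (p - + 1) * z * + 1) * + 1 ≡ p * y
  cancel = solve-∀

S-last-divisible : (p : ℕ) (i : Fin (suc (suc m))) → + p ℤD.∣ S (suc m) p i last
S-last-divisible p zero    = divides (+ 0) refl
S-last-divisible p (suc k) = divides (idMat k last) (trans (S-suc p k last) (x+[p-1]*x≡x*p (idMat k last) (+ p)))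
  where
  x+[p-1]*x≡x*p : ∀ (x p : ℤ) → x + (p - + 1) * x ≡ x * p
  x+[p-1]*x≡x*p = solve-∀

-- The last coordinates of the edges of Sⁿₚ generate pℤ, those of Sⁿ_q lie in qℤ.
congruent⇒∣ : {p q : ℕ} (f : LatticeAffine (suc m)) →
              (∀ i → ∃[ j ] (apply f (S (suc m) p i) ≈ₚ S (suc m) q j)) → q ∣ p
congruent⇒∣ {m} {p} {q} f Sp→Sq = ∣⇒∣ᵤ (subst (+ q ℤD.∣_) A·px-last≡p q∣A·px-last)
  where
  open LatticeAffine f
  x : Pt (suc m)
  x = A⁻¹ ·V e last
  q∣A·edge : ∀ k → + q ℤD.∣ (A ·V edge (S (suc m) p) k) last
  q∣A·edge k with j , fvₖ≈ ← Sp→Sq (suc k) | j₀ , fv₀≈ ← Sp→Sq zero =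
    subst (+ q ℤD.∣_) (trans (cong₂ _-_ (sym (fvₖ≈ last)) (sym (fv₀≈ last))) (apply-diff f (S (suc m) p (suc k)) (S (suc m) p zero) last))
      (ℤD.∣m∣n⇒∣m-n (S-last-divisible q j) (S-last-divisible q j₀))
  c : Fin (suc m) → ℤ
  c = (+ p) *ₚ x -ₚ ((+ p - + 1) * x last) *ₚ 𝟙
  q∣A·px-last : + q ℤD.∣ (A ·V ((+ p) *ₚ x)) last
  q∣A·px-last = subst (+ q ℤD.∣_)
    (sym (trans (·V-cong A (S-scaled-span p x) last) (·V-lincomb A c (edge (S (suc m) p)) last)))
    (∣-sum _ (λ k → ℤD.∣n⇒∣m*n (c k) (q∣A·edge k)))
  A·px-last≡p : (A ·V ((+ p) *ₚ x)) last ≡ + p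
  A·px-last≡p = begin
    (A ·V ((+ p) *ₚ x)) last    ≡⟨ ·V-*ₚ A (+ p) x last ⟩
    + p * (A ·V x) last         ≡⟨ cong (+ p *_) (A-·V-A⁻¹ f (e last) last) ⟩
    + p * idMat last last       ≡⟨ cong (+ p *_) (idMat-diag last) ⟩
    + p * + 1                   ≡⟨ ℤP.*-identityʳ (+ p) ⟩
    + p                         ∎

S-elementary : (p : ℕ) → Elementary (S (suc (suc m)) p)
S-elementary {m} p = primitive-edge⇒elementary {v = S (suc (suc m)) p} zero (e zero , 1≡e₀·edge₀)
  where
  edge₀≈e₀ : edge (S (suc (suc m)) p) zero ≈ₚ e zero
  edge₀≈e₀ r = begin
    edge (S (suc (suc m)) p) zero r                         ≡⟨ trans (edge-S p zero r) (S-suc {suc m} p zero r) ⟩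
    idMat zero r + (+ p - + 1) * idMat zero (last {suc m})  ≡⟨ cong (λ t → idMat zero r + (+ p - + 1) * t) (idMat-off {i = zero} {j = last {suc m}} λ ()) ⟩
    idMat zero r + (+ p - + 1) * + 0                        ≡⟨ cong (_+_ (idMat zero r)) (ℤP.*-zeroʳ (+ p - + 1)) ⟩
    idMat zero r + + 0                                      ≡⟨ ℤP.+-identityʳ (idMat zero r) ⟩
    e zero r                                                ∎
  1≡e₀·edge₀ : sum (λ r → e zero r * edge (S (suc (suc m)) p) zero r) ≡ + 1
  1≡e₀·edge₀ = trans (sum-idMatˡ (edge (S (suc (suc m)) p) zero) zero) (trans (edge₀≈e₀ zero) (idMat-diag {n = suc (suc m)} zero))

-- Barycentric generation

-- (n + 1)(vᵢ - b) for the barycentre b of v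
barycentric : Simplex n → Fin (suc n) → Pt n
barycentric {n} v i r = + suc n * v i r - sum (λ l → v l r)

-- ℤⁿ is spanned by the vectors vᵢ - b.
BarycentricallyGenerated : Simplex n → Set
BarycentricallyGenerated {n} v = ∀ x → ∃ λ c → (+ suc n) *ₚ x ≈ₚ lincomb c (barycentric v)

edgeSum : Simplex n → Pt n
edgeSum v = lincomb 𝟙 (edge v)

lincomb-barycentric : (v : Simplex n) (c : Fin (suc n) → ℤ) →
                      lincomb c (barycentric v) ≈ₚ (+ suc n) *ₚ lincomb (c ∘ suc) (edge v) -ₚ sum c *ₚ edgeSum v
lincomb-barycentric {n} v c r = begin
  sum (λ i → c i * (N * v i r - V))                     ≡⟨ sum-cong-≗ (λ i → distribute (c i) N (v i r) V) ⟩
  sum (λ i → N * (c i * v i r) - c i * V)               ≡⟨ ∑-linear N V (λ i → c i * v i r) c ⟩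
  N * lincomb c v r - sum c * V                         ≡⟨ cong₂ (λ s t → N * s - sum c * t) (lincomb-vertices v c r) V≡ ⟩
  N * (L + sum c * v zero r) - sum c * (edgeSum v r + N * v zero r)
                                                        ≡⟨ cancel N L (sum c) (v zero r) (edgeSum v r) ⟩
  N * L - sum c * edgeSum v r                           ∎
  where
  N : ℤ
  N = + suc n
  V : ℤ
  V = sum (λ l → v l r)
  L : ℤ
  L = lincomb (c ∘ suc) (edge v) r
  V≡ : V ≡ edgeSum v r + N * v zero r
  V≡ = trans (sum-cong-≗ (λ l → sym (ℤP.*-identityˡ (v l r))))
      (trans (lincomb-vertices v 𝟙 r) (cong (λ t → edgeSum v r + t * v zero r) (trans (sum-const {suc n} (+ 1)) (ℤP.*-identityʳ N))))
  distribute : ∀ (c N x V : ℤ) → c * (N * x - V) ≡ N * (c * x) - c * V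
  distribute = solve-∀
  cancel : ∀ (N L s x E : ℤ) → N * (L + s * x) - s * (E + N * x) ≡ N * L - s * E
  cancel = solve-∀

BarycentricallyGenerated-permute : {v : Simplex n} → BarycentricallyGenerated v →
                                   (σ : Permutation′ (suc n)) → BarycentricallyGenerated (v ∘ (σ ⟨$⟩ʳ_))
BarycentricallyGenerated-permute {n} {v} generated σ x with generated x
... | c , Nx≈Σcb = c ∘ (σ ⟨$⟩ʳ_) , λ r → begin
  + suc n * x r                                                ≡⟨ Nx≈Σcb r ⟩
  sum (λ i → c i * barycentric v i r)                          ≡⟨ sum-permute (λ i → c i * barycentric v i r) σ ⟩
  sum (λ i → c (σ ⟨$⟩ʳ i) * barycentric v (σ ⟨$⟩ʳ i) r)         ≡⟨ sum-cong-≗ (λ i → cong (λ s → c (σ ⟨$⟩ʳ i) * (+ suc n * v (σ ⟨$⟩ʳ i) r - s))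
                                                                                          (sum-permute (λ l → v l r) σ)) ⟩
  lincomb (c ∘ (σ ⟨$⟩ʳ_)) (barycentric (v ∘ (σ ⟨$⟩ʳ_))) r      ∎

S-barycentricallyGenerated : {p : ℕ} → p ∣ suc (suc m) → BarycentricallyGenerated (S (suc m) p)
S-barycentricallyGenerated {m} {p} (ℕD.divides q N≡qp) x = c , λ r → sym (begin
  lincomb c (barycentric Sₚ) r                                  ≡⟨ lincomb-barycentric Sₚ c r ⟩
  N * lincomb (c ∘ suc) (edge Sₚ) r - sum c * edgeSum Sₚ r      ≡⟨ cong₂ (λ a b → N * a - b) (lincomb-S p (c ∘ suc) r) (cong₂ _*_ Σc≡ (lincomb-S p 𝟙 r)) ⟩
  N * ((x r + t) + (+ p - + 1) * (x last + t) * + 1)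
    - (+ 0 + (sum x + M * t)) * (+ 1 + (+ p - + 1) * + 1 * + 1) ≡⟨ expand M (+ p) (+ q) (x r) (x last) (sum x) ⟩
  N * x r + (N - + q * + p) * (+ p - + 1) * x last              ≡⟨ cong (λ d → N * x r + d * (+ p - + 1) * x last) N-qp≡0 ⟩
  N * x r + + 0 * (+ p - + 1) * x last                          ≡⟨ x+0*y*z≡x (N * x r) (+ p - + 1) (x last) ⟩
  N * x r                                                       ∎)
  where
  Sₚ : Simplex (suc m)
  Sₚ = S (suc m) p
  N : ℤ
  N = + suc (suc m)
  M : ℤ
  M = + suc m
  -- t is chosen to make the coefficient of (1, …, 1) vanish
  t : ℤ
  t = sum x - + q * (+ p - + 1) * x last
  c : Fin (suc (suc m)) → ℤ
  c = + 0 ∷ (λ k → x k + t)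
  N-qp≡0 : N - + q * + p ≡ + 0
  N-qp≡0 = ℤP.i≡j⇒i-j≡0 (trans (cong +_ N≡qp) (ℤP.pos-* q p))
  Σc≡ : sum c ≡ + 0 + (sum x + M * t)
  Σc≡ = cong (_+_ (+ 0)) (trans (∑-distrib-+ x (λ _ → t)) (cong (_+_ (sum x)) (sum-const {suc m} t)))
  expand : ∀ (M p q y z s : ℤ) →
    (+ 1 + M) * ((y + (s - q * (p - + 1) * z)) + (p - + 1) * (z + (s - q * (p - + 1) * z)) * + 1)
      - (+ 0 + (s + M * (s - q * (p - + 1) * z))) * (+ 1 + (p - + 1) * + 1 * + 1)
    ≡ (+ 1 + M) * y + ((+ 1 + M) - q * p) * (p - + 1) * z
  expand = solve-∀
  x+0*y*z≡x : ∀ (x y z : ℤ) → x + + 0 * y * z ≡ x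
  x+0*y*z≡x = solve-∀

invertible-affine : (M : Mat n) (x₀ : Pt n) → (∀ j → ∃ λ y → (M ·V y) ≈ₚ e j) → (∀ y → (M ·V y) ≈ₚ 0ₚ → y ≈ₚ 0ₚ) →
                    ∃ λ f → ∀ y → apply f ((M ·V y) +ₚ x₀) ≈ₚ y
invertible-affine {n} M x₀ onto one-to-one = f , f-inverts
  where
  preimage : Fin n → Pt n
  preimage j = proj₁ (onto j)
  M⁻¹ : Mat n
  M⁻¹ r j = preimage j r
  M·M⁻¹ : ∀ x → (M ·V (M⁻¹ ·V x)) ≈ₚ x
  M·M⁻¹ x r = begin
    (M ·V (M⁻¹ ·V x)) r                 ≡⟨ ·V-cong M (·V-columns M⁻¹ x) r ⟩
    (M ·V lincomb x preimage) r         ≡⟨ ·V-lincomb M x preimage r ⟩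
    lincomb x (λ j → M ·V preimage j) r ≡⟨ sum-cong-≗ (λ j → cong (x j *_) (proj₂ (onto j) r)) ⟩
    lincomb x e r                       ≡⟨ lincomb-e x r ⟩
    x r                                 ∎
  M⁻¹·M : ∀ x → (M⁻¹ ·V (M ·V x)) ≈ₚ x
  M⁻¹·M x r = ℤP.i-j≡0⇒i≡j _ _ (one-to-one ((M⁻¹ ·V (M ·V x)) -ₚ x)
    (λ k → trans (·V--ₚ M (M⁻¹ ·V (M ·V x)) x k) (ℤP.i≡j⇒i-j≡0 (M·M⁻¹ (M ·V x) k))) r)
  f : LatticeAffine n
  f = mkLatticeAffine M⁻¹ M (ℤ.-1ℤ *ₚ (M⁻¹ ·V x₀)) M⁻¹·M M·M⁻¹
  f-inverts : ∀ y → apply f ((M ·V y) +ₚ x₀) ≈ₚ y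
  f-inverts y r = begin
    (M⁻¹ ·V ((M ·V y) +ₚ x₀)) r + ℤ.-1ℤ * (M⁻¹ ·V x₀) r                ≡⟨ cong (_+ ℤ.-1ℤ * (M⁻¹ ·V x₀) r) (·V-+ₚ M⁻¹ (M ·V y) x₀ r) ⟩
    (M⁻¹ ·V (M ·V y)) r + (M⁻¹ ·V x₀) r + ℤ.-1ℤ * (M⁻¹ ·V x₀) r        ≡⟨ a+c+[-1]*c≡a _ _ ⟩
    (M⁻¹ ·V (M ·V y)) r                                               ≡⟨ M⁻¹·M y r ⟩
    y r                                                               ∎
    where
    a+c+[-1]*c≡a : ∀ (a c : ℤ) → a + c + ℤ.-1ℤ * c ≡ a
    a+c+[-1]*c≡a = solve-∀

module Classification {m : ℕ} (v : Simplex (suc m)) (simplex : IsSimplex v) (generated : BarycentricallyGenerated v) where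

  private
    n′ : ℕ
    n′ = suc m
    N : ℤ
    N = + suc n′
    u : Fin n′ → Pt n′
    u = edge v
    U : Pt n′
    U = edgeSum v

  -- At x = eⱼ the hypothesis reads N eⱼ = N Lⱼ - Mⱼ U.
  coefficients : Fin n′ → Fin (suc n′) → ℤ
  coefficients j = proj₁ (generated (e j))

  L : Fin n′ → Pt n′
  L j = lincomb (coefficients j ∘ suc) u

  M : Fin n′ → ℤ
  M j = sum (coefficients j)

  M·U≈N·[L-e] : ∀ j r → M j * U r ≡ N * (L j r - e j r)
  M·U≈N·[L-e] j r = begin
    M j * U r                          ≡⟨ a≡b-[b-a] (M j * U r) (N * L j r) ⟩
    N * L j r - (N * L j r - M j * U r) ≡⟨ cong (_-_ (N * L j r)) (trans (proj₂ (generated (e j)) r) (lincomb-barycentric v (coefficients j) r)) ⟨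
    N * L j r - N * e j r              ≡⟨ *-distribˡ-- N (L j r) (e j r) ⟨
    N * (L j r - e j r)                ∎
    where
    a≡b-[b-a] : ∀ (a b : ℤ) → a ≡ b - (b - a)
    a≡b-[b-a] = solve-∀

  -- g = κ₀ N + Σⱼ κⱼ₊₁ Mⱼ divides N and every Mⱼ, and N = p g.
  module _ (g p : ℕ) (N≡p*g : suc n′ ≡ p ℕ.* g) (g∣M : ∀ j → + g ℤD.∣ M j)
           (κ : Fin (suc n′) → ℤ) (g≡Σκ : + g ≡ sum (λ i → κ i * (N ∷ M) i)) where

    N≡+p*+g : N ≡ + p * + g
    N≡+p*+g = trans (cong +_ N≡p*g) (ℤP.pos-* p g)

    g≢0 : + g ≢ + 0
    g≢0 g≡0 with () ← trans N≡+p*+g (trans (cong (+ p *_) g≡0) (ℤP.*-zeroʳ (+ p)))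

    +p≢0 : + p ≢ + 0
    +p≢0 p≡0 with () ← trans N≡+p*+g (trans (cong (_* + g) p≡0) (ℤP.*-zeroˡ (+ g)))

    -- the lattice point z = U / p
    z : Pt n′
    z = κ zero *ₚ U +ₚ lincomb (κ ∘ suc) (λ j → L j -ₚ e j)

    g*U≡N*z : ∀ r → + g * U r ≡ N * z r
    g*U≡N*z r = begin
      + g * U r                                                      ≡⟨ cong (_* U r) g≡Σκ ⟩
      (κ zero * N + sum (λ j → κ (suc j) * M j)) * U r               ≡⟨ ℤP.*-distribʳ-+ (U r) (κ zero * N) _ ⟩
      κ zero * N * U r + sum (λ j → κ (suc j) * M j) * U r           ≡⟨ cong (_+_ (κ zero * N * U r)) (*-distribʳ-sum (U r) (λ j → κ (suc j) * M j)) ⟩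
      κ zero * N * U r + sum (λ j → κ (suc j) * M j * U r)           ≡⟨ cong (_+_ (κ zero * N * U r)) (sum-cong-≗ λ j → step j) ⟩
      κ zero * N * U r + sum (λ j → N * (κ (suc j) * (L j r - e j r)))
                                                                     ≡⟨ cong (_+_ (κ zero * N * U r)) (*-distribˡ-sum N (λ j → κ (suc j) * (L j r - e j r))) ⟨
      κ zero * N * U r + N * lincomb (κ ∘ suc) (λ j → L j -ₚ e j) r  ≡⟨ factor (κ zero) N (U r) _ ⟩
      N * z r                                                        ∎
      where
      step : ∀ j → κ (suc j) * M j * U r ≡ N * (κ (suc j) * (L j r - e j r))
      step j = trans (ℤP.*-assoc (κ (suc j)) (M j) (U r))
               (trans (cong (κ (suc j) *_) (M·U≈N·[L-e] j r)) (x∙yz≈y∙xz (κ (suc j)) N _))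
      factor : ∀ (k N U l : ℤ) → k * N * U + N * l ≡ N * (k * U + l)
      factor = solve-∀

    U≡p*z : ∀ r → U r ≡ + p * z r
    U≡p*z r = ℤP.*-cancelˡ-≡ (+ g) (U r) (+ p * z r) {{ℤ.≢-nonZero g≢0}} (begin
      + g * U r            ≡⟨ g*U≡N*z r ⟩
      N * z r              ≡⟨ cong (_* z r) N≡+p*+g ⟩
      + p * + g * z r      ≡⟨ xy∙z≈y∙xz (+ p) (+ g) (z r) ⟩
      + g * (+ p * z r)    ∎)

    -- A sends the edges of Sⁿₚ to those of v.
    A : Mat n′
    A r k = u k r + idMat k last * (z r - U r)

    A·y : ∀ y r → (A ·V y) r ≡ lincomb y u r + y last * (z r - U r)
    A·y y r = begin
      (A ·V y) r                                                          ≡⟨ ·V-columns A y r ⟩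
      sum (λ k → y k * (u k r + idMat k last * (z r - U r)))              ≡⟨ sum-cong-≗ (λ k → distribute (y k) (u k r) (idMat k last) (z r - U r)) ⟩
      sum (λ k → y k * u k r + y k * idMat k last * (z r - U r))          ≡⟨ ∑-distrib-+ (λ k → y k * u k r) (λ k → y k * idMat k last * (z r - U r)) ⟩
      lincomb y u r + sum (λ k → y k * idMat k last * (z r - U r))        ≡⟨ cong (_+_ (lincomb y u r)) (*-distribʳ-sum (z r - U r) (λ k → y k * idMat k last)) ⟨
      lincomb y u r + sum (λ k → y k * idMat k last) * (z r - U r)        ≡⟨ cong (λ t → lincomb y u r + t * (z r - U r)) (sum-idMat y last) ⟩
      lincomb y u r + y last * (z r - U r)                                ∎
      where
      distribute : ∀ (y a d w : ℤ) → y * (a + d * w) ≡ y * a + y * d * w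
      distribute = solve-∀

    lincomb-Sₚ-vertex : ∀ k r → lincomb (S n′ p (suc k)) u r ≡ u k r + (+ p - + 1) * idMat k last * U r
    lincomb-Sₚ-vertex k r = begin
      sum (λ l → S n′ p (suc k) l * u l r)                                   ≡⟨ sum-cong-≗ (λ l → cong (_* u l r) (S-suc p k l)) ⟩
      sum (λ l → (idMat k l + c) * u l r)                                    ≡⟨ sum-cong-≗ (λ l → distribute (idMat k l) c (u l r)) ⟩
      sum (λ l → idMat k l * u l r + c * (+ 1 * u l r))                      ≡⟨ ∑-distrib-+ (λ l → idMat k l * u l r) (λ l → c * (+ 1 * u l r)) ⟩
      sum (λ l → idMat k l * u l r) + sum (λ l → c * (+ 1 * u l r))          ≡⟨ cong₂ _+_ (sum-idMatˡ (λ l → u l r) k) (sym (*-distribˡ-sum c (λ l → + 1 * u l r))) ⟩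
      u k r + c * U r                                                        ∎
      where
      c : ℤ
      c = (+ p - + 1) * idMat k last
      distribute : ∀ (a c x : ℤ) → (a + c) * x ≡ a * x + c * (+ 1 * x)
      distribute = solve-∀

    A·Sₚ : ∀ i → (A ·V S n′ p i) ≈ₚ v i -ₚ v zero
    A·Sₚ zero    r = trans (·V-sum A (S n′ p zero) r)
                       (trans (sum-zero _ (λ k → ℤP.*-zeroʳ (A r k))) (sym (ℤP.+-inverseʳ (v zero r))))
    A·Sₚ (suc k) r = begin
      (A ·V S n′ p (suc k)) r                                              ≡⟨ A·y (S n′ p (suc k)) r ⟩
      lincomb (S n′ p (suc k)) u r + S n′ p (suc k) last * (z r - U r)     ≡⟨ cong₂ (λ a b → a + b * (z r - U r)) (lincomb-Sₚ-vertex k r) (S-suc p k last) ⟩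
      u k r + (+ p - + 1) * δ * U r + (idMat k last + (+ p - + 1) * δ) * (z r - U r)
                                                                           ≡⟨ cong (λ a → u k r + (+ p - + 1) * δ * a + (δ + (+ p - + 1) * δ) * (z r - a)) (U≡p*z r) ⟩
      u k r + (+ p - + 1) * δ * (+ p * z r) + (δ + (+ p - + 1) * δ) * (z r - + p * z r)
                                                                           ≡⟨ cancel (u k r) (+ p) δ (z r) ⟩
      u k r                                                                ∎
      where
      δ : ℤ
      δ = idMat k last
      cancel : ∀ (u p δ z : ℤ) → u + (p - + 1) * δ * (p * z) + (δ + (p - + 1) * δ) * (z - p * z) ≡ u
      cancel = solve-∀

    A·𝟙 : ∀ r → (A ·V 𝟙) r ≡ z r
    A·𝟙 r = trans (A·y 𝟙 r) (U+1*[z-U]≡z (U r) (z r))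
      where
      U+1*[z-U]≡z : ∀ (U z : ℤ) → U + + 1 * (z - U) ≡ z
      U+1*[z-U]≡z = solve-∀

    -- eⱼ = Lⱼ - aⱼ z where Mⱼ = aⱼ g
    A-onto : ∀ j → ∃ λ y → (A ·V y) ≈ₚ e j
    A-onto j = y , λ r → ℤP.*-cancelˡ-≡ N ((A ·V y) r) (e j r) (begin
      N * (A ·V y) r
                                                  ≡⟨ cong (N *_) (trans (·V--ₚ A Σcₖsₖ (a *ₚ 𝟙) r) (cong₂ _-_ (·V-lincomb A (coefficients j ∘ suc) (S n′ p ∘ suc) r) (·V-*ₚ A a 𝟙 r))) ⟩
      N * (lincomb (coefficients j ∘ suc) (λ k → A ·V S n′ p (suc k)) r - a * (A ·V 𝟙) r)
                                                  ≡⟨ cong₂ (λ s t → N * (s - a * t)) (sum-cong-≗ (λ k → cong (coefficients j (suc k) *_) (A·Sₚ (suc k) r))) (A·𝟙 r) ⟩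
      N * (L j r - a * z r)                       ≡⟨ expand N (L j r) a (z r) ⟩
      N * L j r - a * (N * z r)                   ≡⟨ cong (λ t → N * L j r - a * t) (g*U≡N*z r) ⟨
      N * L j r - a * (+ g * U r)                 ≡⟨ cong (_-_ (N * L j r)) (trans (sym (ℤP.*-assoc a (+ g) (U r))) (cong (_* U r) (sym M≡a*g))) ⟩
      N * L j r - M j * U r                       ≡⟨ cong (_-_ (N * L j r)) (M·U≈N·[L-e] j r) ⟩
      N * L j r - N * (L j r - e j r)             ≡⟨ cancel N (L j r) (e j r) ⟩
      N * e j r                                   ∎)
      where
      a : ℤ
      a = ℤD.quotient (g∣M j)
      Σcₖsₖ : Pt n′
      Σcₖsₖ = lincomb (coefficients j ∘ suc) (S n′ p ∘ suc)
      y : Pt n′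
      y = Σcₖsₖ -ₚ a *ₚ 𝟙
      M≡a*g : M j ≡ a * + g
      M≡a*g = ℤD._∣_.equality (g∣M j)
      expand : ∀ (N l a z : ℤ) → N * (l - a * z) ≡ N * l - a * (N * z)
      expand = solve-∀
      cancel : ∀ (N l x : ℤ) → N * l - N * (l - x) ≡ N * x
      cancel = solve-∀

    -- p · A y = Σₖ (p yₖ - (p - 1) y_last) uₖ
    A-one-to-one : ∀ y → (A ·V y) ≈ₚ 0ₚ → y ≈ₚ 0ₚ
    A-one-to-one y Ay≈0 k = ℤP.*-cancelˡ-≡ (+ p) (y k) (+ 0) {{ℤ.≢-nonZero +p≢0}} (trans p*yₖ≡0 (sym (ℤP.*-zeroʳ (+ p))))
      where
      c : Fin n′ → ℤ
      c k = + p * y k - (+ p - + 1) * y last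
      Σcu≡p*Ay : ∀ r → lincomb c u r ≡ + p * (A ·V y) r
      Σcu≡p*Ay r = begin
        sum (λ k → c k * u k r)                                                   ≡⟨ sum-cong-≗ (λ k → distribute (+ p) (y k) (y last) (u k r)) ⟩
        sum (λ k → + p * (y k * u k r) - + 1 * u k r * ((+ p - + 1) * y last))    ≡⟨ ∑-linear (+ p) ((+ p - + 1) * y last) (λ k → y k * u k r) (λ k → + 1 * u k r) ⟩
        + p * lincomb y u r - U r * ((+ p - + 1) * y last)                        ≡⟨ cong (λ t → + p * lincomb y u r - t * ((+ p - + 1) * y last)) (U≡p*z r) ⟩
        + p * lincomb y u r - + p * z r * ((+ p - + 1) * y last)                  ≡⟨ regroup (+ p) (lincomb y u r) (z r) (y last) ⟩
        + p * (lincomb y u r + y last * (z r - + p * z r))                        ≡⟨ cong (λ t → + p * (lincomb y u r + y last * (z r - t))) (U≡p*z r) ⟨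
        + p * (lincomb y u r + y last * (z r - U r))                              ≡⟨ cong (+ p *_) (A·y y r) ⟨
        + p * (A ·V y) r                                                          ∎
        where
        distribute : ∀ (p a b u : ℤ) → (p * a - (p - + 1) * b) * u ≡ p * (a * u) - + 1 * u * ((p - + 1) * b)
        distribute = solve-∀
        regroup : ∀ (p L z b : ℤ) → p * L - p * z * ((p - + 1) * b) ≡ p * (L + b * (z - p * z))
        regroup = solve-∀
      c≡0 : ∀ k → c k ≡ + 0
      c≡0 = simplex⇒independent {v = v} simplex c (λ r → trans (Σcu≡p*Ay r) (trans (cong (+ p *_) (Ay≈0 r)) (ℤP.*-zeroʳ (+ p))))
      y-last≡0 : y last ≡ + 0
      y-last≡0 = trans (b≡p*b-[p-1]*b (+ p) (y last)) (c≡0 last)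
        where
        b≡p*b-[p-1]*b : ∀ (p b : ℤ) → b ≡ p * b - (p - + 1) * b
        b≡p*b-[p-1]*b = solve-∀
      p*yₖ≡0 : + p * y k ≡ + 0
      p*yₖ≡0 = begin
        + p * y k                                  ≡⟨ a≡a-b+b (+ p * y k) ((+ p - + 1) * y last) ⟩
        c k + (+ p - + 1) * y last                 ≡⟨ cong₂ (λ s t → s + (+ p - + 1) * t) (c≡0 k) y-last≡0 ⟩
        + 0 + (+ p - + 1) * + 0                    ≡⟨ 0+a*0≡0 (+ p - + 1) ⟩
        + 0                                        ∎
        where
        a≡a-b+b : ∀ (a b : ℤ) → a ≡ a - b + b
        a≡a-b+b = solve-∀
        0+a*0≡0 : ∀ (a : ℤ) → + 0 + a * + 0 ≡ + 0
        0+a*0≡0 = solve-∀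

    congruent-to-Sₚ : ∃ λ f → ∀ i → apply f (v i) ≈ₚ S n′ p i
    congruent-to-Sₚ = f , λ i r → trans (apply-cong f (λ k → vᵢ≈ i k) r) (f-inverts (S n′ p i) r)
      where
      inverse-of-A : (∀ y → (A ·V y) ≈ₚ 0ₚ → y ≈ₚ 0ₚ) → ∃ λ f → ∀ y → apply f ((A ·V y) +ₚ v zero) ≈ₚ y
      inverse-of-A = invertible-affine A (v zero) A-onto
      f : LatticeAffine n′
      f = proj₁ (inverse-of-A A-one-to-one)
      f-inverts : ∀ y → apply f ((A ·V y) +ₚ v zero) ≈ₚ y
      f-inverts = proj₂ (inverse-of-A A-one-to-one)
      vᵢ≈ : ∀ i → v i ≈ₚ (A ·V S n′ p i) +ₚ v zero
      vᵢ≈ i k = trans (a≡[a-b]+b (v i k) (v zero k)) (cong (_+ v zero k) (sym (A·Sₚ i k)))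
        where
        a≡[a-b]+b : ∀ (a b : ℤ) → a ≡ (a - b) + b
        a≡[a-b]+b = solve-∀

  classification : ∃ λ p → 1 ≤ p × p ∣ suc n′ × ∃ λ f → ∀ i → apply f (v i) ≈ₚ S n′ p i
  classification = from-gcd (bézout (N ∷ M))
    where
    from-gcd : (∃ λ g → (∀ i → + g ℤD.∣ (N ∷ M) i) × ∃ λ κ → + g ≡ sum (λ i → κ i * (N ∷ M) i)) →
               ∃ λ p → 1 ≤ p × p ∣ suc n′ × ∃ λ f → ∀ i → apply f (v i) ≈ₚ S n′ p i
    from-gcd (g , g∣ , κ , g≡Σκ) with ∣⇒∣ᵤ (g∣ zero)
    ... | ℕD.divides zero    ()
    ... | ℕD.divides (suc p) N≡p*g =
      suc p , ℕ.s≤s ℕ.z≤n , ℕD.divides g (trans N≡p*g (ℕP.*-comm (suc p) g)) ,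
      congruent-to-Sₚ g (suc p) N≡p*g (g∣ ∘ suc) κ g≡Σκ

-- Regular elementary simplices

transpose-matchˡ : (i j : Fin n) → transpose i j ⟨$⟩ʳ i ≡ j
transpose-matchˡ i j with i Fin.≟ i
... | yes _  = refl
... | no i≢i = ⊥-elim (i≢i refl)

transpose-matchʳ : (i j : Fin n) → transpose i j ⟨$⟩ʳ j ≡ i
transpose-matchʳ i j with j Fin.≟ i
... | yes j≡i = j≡i
... | no _ with j Fin.≟ j
...   | yes _  = refl
...   | no j≢j = ⊥-elim (j≢j refl)

transpose-other : {i j k : Fin n} → k ≢ i → k ≢ j → transpose i j ⟨$⟩ʳ k ≡ k
transpose-other {i = i} {j} {k} k≢i k≢j with k Fin.≟ i
... | yes k≡i = ⊥-elim (k≢i k≡i)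
... | no _ with k Fin.≟ j
...   | yes k≡j = ⊥-elim (k≢j k≡j)
...   | no _    = refl

realised-edge : {v : Simplex n} {σ : Permutation′ (suc n)} (f : LatticeAffine n) →
                (∀ i → apply f (v i) ≈ₚ v (σ ⟨$⟩ʳ i)) →
                ∀ k → (LatticeAffine.A f ·V edge v k) ≈ₚ v (σ ⟨$⟩ʳ suc k) -ₚ v (σ ⟨$⟩ʳ zero)
realised-edge {v = v} f realises k r =
  trans (sym (apply-diff f (v (suc k)) (v zero) r)) (cong₂ _-_ (realises (suc k) r) (realises zero r))

module RegularElementary {m : ℕ} (v : Simplex (suc m)) (simplex : IsSimplex v)
                         (elementary : Elementary v) (regular : LatticeRegular v) where

  private
    n′ : ℕ
    n′ = suc m
    N : ℤ
    N = + suc n′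
    u : Fin n′ → Pt n′
    u = edge v
    U : Pt n′
    U = edgeSum v
    symmetric : FullySymmetric v
    symmetric = regular⇒fullySymmetric {v = v} simplex regular

  edge-nonzero : ∀ k → ¬ (u k ≈ₚ 0ₚ)
  edge-nonzero k uₖ≈0 = 1≢0 (trans (sym (idMat-diag k)) (simplex⇒independent {v = v} simplex (e k) Σeu≈0 k))
    where
    1≢0 : + 1 ≢ + 0
    1≢0 ()
    Σeu≈0 : lincomb (e k) u ≈ₚ 0ₚ
    Σeu≈0 r = trans (sum-idMatˡ (λ l → u l r) k) (uₖ≈0 r)

  -- the map swapping v_{k+1} and v_{l+1} carries edge k to edge l
  edges-divisible : ∀ {t} k → t ∣ₚ u k → ∀ l → t ∣ₚ u l
  edges-divisible k t∣uₖ l = ∣ₚ-resp-≈ₚ Auₖ≈uₗ (·V-∣ₚ (LatticeAffine.A f) t∣uₖ)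
    where
    σ : Permutation′ (suc n′)
    σ = transpose (suc k) (suc l)
    f : LatticeAffine n′
    f = proj₁ (symmetric σ)
    Auₖ≈uₗ : (LatticeAffine.A f ·V u k) ≈ₚ u l
    Auₖ≈uₗ r = trans (realised-edge {v = v} {σ = σ} f (proj₂ (symmetric σ)) k r)
      (cong₂ (λ a b → v a r - v b r) (transpose-matchˡ (suc k) (suc l)) (transpose-other {i = suc k} {j = suc l} (λ ()) (λ ())))

  edge-primitive : ∀ k → Primitive (u k)
  edge-primitive k with primitive-trichotomy (u k)
  ... | inj₁ uₖ≈0                     = ⊥-elim (edge-nonzero k uₖ≈0)
  ... | inj₂ (inj₁ uₖ-primitive)       = uₖ-primitive
  ... | inj₂ (inj₂ (t , 2≤t , t∣uₖ))  = ⊥-elim (edges-divisible⇒¬elementary {v = v} 2≤t (edges-divisible k t∣uₖ) elementary)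

  reflection-edge : ∀ i (f : LatticeAffine n′) → (∀ j → apply f (v j) ≈ₚ v (transpose zero (suc i) ⟨$⟩ʳ j)) →
                    ∀ k r → (LatticeAffine.A f ·V u k) r ≡ u k r - u i r - idMat k i * u i r
  reflection-edge i f realises k r = trans (realised-edge {v = v} {σ = σ} f realises k r) (cases (k Fin.≟ i))
    where
    σ : Permutation′ (suc n′)
    σ = transpose zero (suc i)
    cases : Dec (k ≡ i) → v (σ ⟨$⟩ʳ suc k) r - v (σ ⟨$⟩ʳ zero) r ≡ u k r - u i r - idMat k i * u i r
    cases (yes refl) = begin
      v (σ ⟨$⟩ʳ suc i) r - v (σ ⟨$⟩ʳ zero) r     ≡⟨ cong₂ (λ a b → v a r - v b r) (transpose-matchʳ zero (suc i)) (transpose-matchˡ zero (suc i)) ⟩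
      v zero r - v (suc i) r                    ≡⟨ a-b≡[b-a]-[b-a]-1*[b-a] (v zero r) (v (suc i) r) ⟩
      u i r - u i r - + 1 * u i r               ≡⟨ cong (λ t → u i r - u i r - t * u i r) (idMat-diag i) ⟨
      u i r - u i r - idMat i i * u i r         ∎
      where
      a-b≡[b-a]-[b-a]-1*[b-a] : ∀ (a b : ℤ) → a - b ≡ (b - a) - (b - a) - + 1 * (b - a)
      a-b≡[b-a]-[b-a]-1*[b-a] = solve-∀
    cases (no k≢i) = begin
      v (σ ⟨$⟩ʳ suc k) r - v (σ ⟨$⟩ʳ zero) r     ≡⟨ cong₂ (λ a b → v a r - v b r) (transpose-other {i = zero} {j = suc i} (λ ()) (k≢i ∘ FinP.suc-injective)) (transpose-matchˡ zero (suc i)) ⟩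
      v (suc k) r - v (suc i) r                 ≡⟨ c-b≡[c-a]-[b-a]-0*[b-a] (v zero r) (v (suc i) r) (v (suc k) r) ⟩
      u k r - u i r - + 0 * u i r               ≡⟨ cong (λ t → u k r - u i r - t * u i r) (idMat-off k≢i) ⟨
      u k r - u i r - idMat k i * u i r         ∎
      where
      c-b≡[c-a]-[b-a]-0*[b-a] : ∀ (a b c : ℤ) → c - b ≡ (c - a) - (b - a) - + 0 * (b - a)
      c-b≡[c-a]-[b-a]-0*[b-a] = solve-∀

  module _ (x : Pt n′) (N′ : ℤ) (β : Fin n′ → ℤ) (N′≢0 : N′ ≢ + 0) (N′x≈Σβu : N′ *ₚ x ≈ₚ lincomb β u) where

    private
      Σβ : ℤ
      Σβ = sum β

    -- the reflection in the i-th edge gives N′ (x - A x) = (Σβ + βᵢ) uᵢ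
    N′∣Σβ+β : ∀ i → N′ ℤD.∣ Σβ + β i
    N′∣Σβ+β i = primitive-∣ {w = x -ₚ (A ·V x)} (edge-primitive i) (λ r → begin
      N′ * (x r - (A ·V x) r)                                            ≡⟨ *-distribˡ-- N′ (x r) ((A ·V x) r) ⟩
      N′ * x r - N′ * (A ·V x) r                                         ≡⟨ cong₂ _-_ (N′x≈Σβu r) (sym (·V-*ₚ A N′ x r)) ⟩
      lincomb β u r - (A ·V (N′ *ₚ x)) r                                 ≡⟨ cong (_-_ (lincomb β u r)) (trans (·V-cong A N′x≈Σβu r) (·V-lincomb A β u r)) ⟩
      lincomb β u r - lincomb β (λ k → A ·V u k) r                       ≡⟨ ∑-distrib-- (λ k → β k * u k r) (λ k → β k * (A ·V u k) r) ⟨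
      sum (λ k → β k * u k r - β k * (A ·V u k) r)                       ≡⟨ sum-cong-≗ (λ k → cong (λ t → β k * u k r - β k * t) (reflection-edge i f (proj₂ (symmetric σ)) k r)) ⟩
      sum (λ k → β k * u k r - β k * (u k r - u i r - idMat k i * u i r)) ≡⟨ sum-cong-≗ (λ k → simplify (β k) (u k r) (u i r) (idMat k i)) ⟩
      sum (λ k → β k * u i r + β k * idMat k i * u i r)                  ≡⟨ ∑-distrib-+ (λ k → β k * u i r) (λ k → β k * idMat k i * u i r) ⟩
      sum (λ k → β k * u i r) + sum (λ k → β k * idMat k i * u i r)      ≡⟨ cong₂ _+_ (*-distribʳ-sum (u i r) β) (*-distribʳ-sum (u i r) (λ k → β k * idMat k i)) ⟨
      Σβ * u i r + sum (λ k → β k * idMat k i) * u i r                    ≡⟨ cong (λ t → Σβ * u i r + t * u i r) (sum-idMat β i) ⟩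
      Σβ * u i r + β i * u i r                                            ≡⟨ ℤP.*-distribʳ-+ (u i r) Σβ (β i) ⟨
      (Σβ + β i) * u i r                                                  ∎)
      where
      σ : Permutation′ (suc n′)
      σ = transpose zero (suc i)
      f : LatticeAffine n′
      f = proj₁ (symmetric σ)
      A : Mat n′
      A = LatticeAffine.A f
      simplify : ∀ (b a c d : ℤ) → b * a - b * (a - c - d * c) ≡ b * c + b * d * c
      simplify = solve-∀
    K : Fin n′ → ℤ
    K i = ℤD.quotient (N′∣Σβ+β i)
    β≡K*N′-S : ∀ k → β k ≡ K k * N′ - Σβ
    β≡K*N′-S k = trans (b≡[a+b]-a Σβ (β k)) (cong (_- Σβ) (ℤD._∣_.equality (N′∣Σβ+β k)))
      where
      b≡[a+b]-a : ∀ (a b : ℤ) → b ≡ (a + b) - a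
      b≡[a+b]-a = solve-∀
    N*Σβ≡N′*ΣK : N * Σβ ≡ N′ * sum K
    N*Σβ≡N′*ΣK = begin
      N * Σβ                                ≡⟨ [1+n]*Σβ≡n*Σβ+Σβ (+ n′) Σβ ⟩
      + n′ * Σβ + Σβ                         ≡⟨ cong₂ _+_ (sum-const {n′} Σβ) refl ⟨
      sum (λ (_ : Fin n′) → Σβ) + sum β     ≡⟨ ∑-distrib-+ (λ _ → Σβ) β ⟨
      sum (λ k → Σβ + β k)                  ≡⟨ sum-cong-≗ (λ k → ℤD._∣_.equality (N′∣Σβ+β k)) ⟩
      sum (λ k → K k * N′)                 ≡⟨ *-distribʳ-sum N′ K ⟨
      sum K * N′                           ≡⟨ ℤP.*-comm (sum K) N′ ⟩
      N′ * sum K                           ∎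
      where
      [1+n]*Σβ≡n*Σβ+Σβ : ∀ (n Σβ : ℤ) → (+ 1 + n) * Σβ ≡ n * Σβ + Σβ
      [1+n]*Σβ≡n*Σβ+Σβ = solve-∀

    integral-coefficients : N *ₚ x ≈ₚ N *ₚ lincomb K u -ₚ sum K *ₚ U
    integral-coefficients r = ℤP.*-cancelˡ-≡ N′ (N * x r) (N * lincomb K u r - sum K * U r) {{ℤ.≢-nonZero N′≢0}} (begin
      N′ * (N * x r)                                   ≡⟨ x∙yz≈y∙xz N′ N (x r) ⟩
      N * (N′ * x r)                                   ≡⟨ cong (N *_) (N′x≈Σβu r) ⟩
      N * sum (λ k → β k * u k r)                      ≡⟨ cong (N *_) (sum-cong-≗ (λ k → cong (_* u k r) (β≡K*N′-S k))) ⟩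
      N * sum (λ k → (K k * N′ - Σβ) * u k r)           ≡⟨ cong (N *_) (sum-cong-≗ (λ k → distribute (K k) N′ Σβ (u k r))) ⟩
      N * sum (λ k → N′ * (K k * u k r) - + 1 * u k r * Σβ)
                                                       ≡⟨ cong (N *_) (∑-linear N′ Σβ (λ k → K k * u k r) (λ k → + 1 * u k r)) ⟩
      N * (N′ * lincomb K u r - U r * Σβ)               ≡⟨ regroup N N′ (lincomb K u r) (U r) Σβ ⟩
      N′ * (N * lincomb K u r) - N * Σβ * U r           ≡⟨ cong (λ t → N′ * (N * lincomb K u r) - t * U r) N*Σβ≡N′*ΣK ⟩
      N′ * (N * lincomb K u r) - N′ * sum K * U r      ≡⟨ factor N′ (N * lincomb K u r) (sum K) (U r) ⟩
      N′ * (N * lincomb K u r - sum K * U r)           ∎)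
      where
      distribute : ∀ (k N Σβ u : ℤ) → (k * N - Σβ) * u ≡ N * (k * u) - + 1 * u * Σβ
      distribute = solve-∀
      regroup : ∀ (N N′ L U Σβ : ℤ) → N * (N′ * L - U * Σβ) ≡ N′ * (N * L) - N * Σβ * U
      regroup = solve-∀
      factor : ∀ (N′ a b U : ℤ) → N′ * a - N′ * b * U ≡ N′ * (a - b * U)
      factor = solve-∀

  barycentricallyGenerated : BarycentricallyGenerated v
  barycentricallyGenerated x = from-rational (rational-span {w = u} (simplex⇒independent {v = v} simplex) x)
    where
    from-rational : (∃₂ λ N′ β → N′ ≢ + 0 × N′ *ₚ x ≈ₚ lincomb β u) → ∃ λ c → N *ₚ x ≈ₚ lincomb c (barycentric v)
    from-rational (N′ , β , N′≢0 , N′x≈Σβu) = + 0 ∷ K x N′ β N′≢0 N′x≈Σβu , λ r → begin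
      N * x r                                                      ≡⟨ integral-coefficients x N′ β N′≢0 N′x≈Σβu r ⟩
      N * lincomb K′ u r - sum K′ * U r                            ≡⟨ cong (λ t → N * lincomb K′ u r - t * U r) (ℤP.+-identityˡ (sum K′)) ⟨
      N * lincomb K′ u r - (+ 0 + sum K′) * U r                    ≡⟨ lincomb-barycentric v (+ 0 ∷ K′) r ⟨
      lincomb (+ 0 ∷ K′) (barycentric v) r                         ∎
      where
      K′ : Fin n′ → ℤ
      K′ = K x N′ β N′≢0 N′x≈Σβu

congruent⇒≡ : {p q : ℕ} → LatticeCongruent (S (suc m) p) (S (suc m) q) → p ≡ q
congruent⇒≡ (f , mapsOnto) =
  ℕD.∣-antisym (congruent⇒∣ (inverse f) (proj₁ (mapsOnto-inverse f mapsOnto))) (congruent⇒∣ f (proj₁ mapsOnto))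

-- Applied to Sⁿₚ relabelled by σ⁻¹, the classification yields a lattice map realising σ.
S-fullySymmetric : {p : ℕ} → 1 ≤ p → p ∣ suc (suc m) → FullySymmetric (S (suc m) p)
S-fullySymmetric {m} {p} 1≤p p∣N σ = realise (Classification.classification w w-simplex w-generated)
  where
  Sₚ : Simplex (suc m)
  Sₚ = S (suc m) p
  w : Simplex (suc m)
  w = Sₚ ∘ (σ ⟨$⟩ˡ_)
  w-simplex : IsSimplex w
  w-simplex = IsSimplex-permute {v = Sₚ} (independent⇒simplex {v = Sₚ} (S-independent p 1≤p)) (Perm.flip σ)
  w-generated : BarycentricallyGenerated w
  w-generated = BarycentricallyGenerated-permute {v = Sₚ} (S-barycentricallyGenerated p∣N) (Perm.flip σ)
  realise : (∃ λ p′ → 1 ≤ p′ × p′ ∣ suc (suc m) × ∃ λ f → ∀ i → apply f (w i) ≈ₚ S (suc m) p′ i) →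
            ∃ λ f → ∀ i → apply f (Sₚ i) ≈ₚ Sₚ (σ ⟨$⟩ʳ i)
  realise (p′ , _ , _ , f , f-maps) = f , λ i r → trans (f-realises i r) (cong (λ q → S (suc m) q (σ ⟨$⟩ʳ i) r) p′≡p)
    where
    f-realises : ∀ i → apply f (Sₚ i) ≈ₚ S (suc m) p′ (σ ⟨$⟩ʳ i)
    f-realises i r = trans (cong (λ j → apply f (Sₚ j) r) (sym (Perm.inverseˡ σ))) (f-maps (σ ⟨$⟩ʳ i) r)
    p′≡p : p′ ≡ p
    p′≡p = sym (congruent⇒≡ (f , (λ i → σ ⟨$⟩ʳ i , f-realises i) , (λ j → σ ⟨$⟩ˡ j , f-maps j)))

elementary-segment-length : (v : Simplex 1) → IsSimplex v → Elementary v → latticeLength₁ v ≡ 1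
elementary-segment-length v simplex elementary with latticeLength₁ v in length≡
... | 0           = ⊥-elim (0≢1 (simplex-vertices-distinct {v = v} simplex v₀≈v₁))
  where
  0≢1 : zero ≢ suc zero
  0≢1 ()
  v₀≈v₁ : v zero ≈ₚ v (suc zero)
  v₀≈v₁ zero = ℤP.i-j≡0⇒i≡j _ _ (ℤP.∣i∣≡0⇒i≡0 length≡)
... | 1           = refl
... | suc (suc l) = ⊥-elim (edges-divisible⇒¬elementary {v = v} (s≤s (s≤s z≤n)) L∣edge elementary)
  where
  L∣edge : ∀ k → (+ suc (suc l)) ∣ₚ edge v k
  L∣edge zero zero = subst (ℤD._∣ edge v zero zero)
    (cong +_ (trans (ℤP.∣i-j∣≡∣j-i∣ (v (suc zero) zero) (v zero zero)) length≡)) ℤD.∣m∣∣m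

regular-elementary⇒congruent : (v : Simplex (suc m)) → IsSimplex v → Elementary v → LatticeRegular v →
                               ∃[ p ] (1 ≤ p × p ∣ suc (suc m) × LatticeCongruent v (S (suc m) p))
regular-elementary⇒congruent {m} v simplex elementary regular = congruent
  (Classification.classification v simplex (RegularElementary.barycentricallyGenerated v simplex elementary regular))
  where
  congruent : (∃ λ p → 1 ≤ p × p ∣ suc (suc m) × ∃ λ f → ∀ i → apply f (v i) ≈ₚ S (suc m) p i) →
              ∃[ p ] (1 ≤ p × p ∣ suc (suc m) × LatticeCongruent v (S (suc m) p))
  congruent (p , 1≤p , p∣N , f , f-maps) = p , 1≤p , p∣N , f , (λ i → i , f-maps i) , (λ i → i , f-maps i)

proposition2 :
    -- (Sym₁)
    ((v : Simplex 1) → IsSimplex v → Elementary v → LatticeRegular v →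
      latticeLength₁ v ≡ 1)
    ×
    -- (Symₙ), n > 1
    ((n : ℕ) → 2 ≤ n →
      -- (i)
      ((p : ℕ) → 1 ≤ p → p ∣ suc n →
        Elementary (S n p) × LatticeRegular (S n p))
      ×
      -- (ii)
      ((p q : ℕ) → 1 ≤ p → p ∣ suc n → 1 ≤ q → q ∣ suc n → p ≢ q →
        ¬ LatticeCongruent (S n p) (S n q))
      ×
      -- (iii)
      ((v : Simplex n) → IsSimplex v → Elementary v → LatticeRegular v →
        ∃[ p ] (1 ≤ p × p ∣ suc n × LatticeCongruent v (S n p))))
proposition2 = (λ v simplex elementary _ → elementary-segment-length v simplex elementary) , λ
  { zero ()
  ; (suc zero) (s≤s ())
  ; (suc (suc m)) _ →
      (λ p 1≤p p∣N → S-elementary p , fullySymmetric⇒regular {v = S (suc (suc m)) p} (S-fullySymmetric 1≤p p∣N)) ,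
      (λ p q _ _ _ _ p≢q → p≢q ∘ congruent⇒≡) ,
      regular-elementary⇒congruent
  }
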